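{- Let $\overline{P}$ be a Gauss code over $E=\{1,\dots,n\}$. For each $2$-face colorable realization of $\overline{P}$ in $\mathbb{S}^2$, in $\mathbb{R}\mathbb{P}^2$ or in the Klein bottle, setting $\gamma_k=1$ if $k$ is black and $\gamma_k=0$ if $k$ is white, there exist $\delta_1,\dots,\delta_n\in\mathbb{Z}_2$ such that $(\delta_1,\dots,\delta_n,\gamma_1,\dots,\gamma_n)$ satisfies the following system of $n$ vector equations over $\mathbb{Z}_2$ (vectors in $\mathbb{Z}_2^E$, written as formal sums of elements of $E$): for $k\in\mathcal{O}$: $\ i_{\overline{P}}^2(k)+\sum_{\ell\in i_{\overline{P}}(k)}(1+\gamma_k+\gamma_\ell)\,\ell=\sum_{\ell\in\mathcal{E}}\delta_\ell\,\ell+\sum_{\ell\in\mathcal{O}}(1+\delta_k+\delta_\ell)\,\ell$; for $k\in\mathcal{E}$: $\ i_{\overline{P}}^2(k)+\sum_{\ell\in i_{\overline{P}}(k)}(1+\gamma_k+\gamma_\ell)\,\ell=\delta_k\sum_{\ell\in\mathcal{O}}\ell$.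
   Context: A Gauss code over $E=\{1,\dots,n\}$ is a cyclic sequence $\overline{P}$ of length $2n$ in which each element of $E$ occurs twice. A $2$-face colorable realization (lacet) of $\overline{P}$ on a closed surface $S$ is a closed curve with exactly $n$ simple transversal self-intersections labelled by $E$, met in the cyclic order $\overline{P}$, inducing a cellularly embedded $4$-regular graph whose faces can be properly $2$-coloured. It is the medial map of a map $M$ (graph with edge set $E$ cellularly embedded in $S$) having a single zigzag (closed walk alternately turning leftmost/rightmost at each vertex) that traverses the edges in the cyclic order $\overline{P}$; an edge $k$ is black if the zigzag traverses it twice in the same direction, white otherwise. Identify subsets of $E$ with vectors in $\mathbb{Z}_2^E$ and $x$ with $\{x\}$. $i_{\overline{P}}$ is the $\mathbb{Z}_2$-linear map with $i_{\overline{P}}(x)$ = set of elements occurring exactly once in $\overline{P}$ strictly between the two occurrences of $x$. $\mathcal{O}=\{x\in E:|i_{\overline{P}}(x)|\text{ odd}\}$, $\mathcal{E}=E\setminus\mathcal{O}$. -}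

module Defs where

open import Data.Nat using (ℕ; zero; suc; _+_; _*_)
open import Data.Fin using (Fin; toℕ)
open import Data.Fin.Properties using (_≟_)
open import Data.Bool using (Bool; true; false; _xor_; _∧_; not; if_then_else_)
open import Data.Product using (Σ; ∃; _×_; _,_)
open import Data.Sum using (_⊎_)
open import Relation.Binary.PropositionalEquality using (_≡_; _≢_)
open import Relation.Nullary using (¬_; yes; no)
open import Relation.Binary.Construct.Closure.ReflexiveTransitive using (Star)
open import Function using (_⇔_; _∘_)

count : ∀ {k} → (Fin k → Bool) → ℕ
count {zero}  p = 0
count {suc k} p = (if p Fin.zero then 1 else 0) + count {k} (p ∘ Fin.suc)
  where import Data.Fin as Fin

⊕sum : ∀ {k} → (Fin k → Bool) → Bool
⊕sum {zero}  p = false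
⊕sum {suc k} p = p Fin.zero xor ⊕sum {k} (p ∘ Fin.suc)
  where import Data.Fin as Fin

is : ∀ {n} → Fin n → Fin n → Bool
is x y with x ≟ y
... | yes _ = true
... | no _  = false

isℕ : ℕ → ℕ → Bool
isℕ zero zero = true
isℕ (suc a) (suc b) = isℕ a b
isℕ _ _ = false

-- Gauss codes.  A cyclic sequence of length 2n is represented by a
-- linear representative  w : Fin (2 * n) → Fin n  (position ↦ letter).

IsGaussCode : ∀ {n} → (Fin (2 * n) → Fin n) → Set
IsGaussCode {n} w = ∀ (x : Fin n) → count (λ t → is (w t) x) ≡ 2

before : ∀ {n} → (Fin (2 * n) → Fin n) → Fin n → Fin (2 * n) → ℕ
before w x t = count (λ s → (toℕ s <ᵇ toℕ t) ∧ is (w s) x)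
  where open import Data.Nat using (_<ᵇ_)

between : ∀ {n} → (Fin (2 * n) → Fin n) → Fin n → Fin (2 * n) → Bool
between w x t = isℕ (before w x t) 1 ∧ not (is (w t) x)

-- i_P(x) as a vector of Z₂^E : y ∈ i_P(x) iff y occurs exactly once
-- strictly between the two occurrences of x.
iP : ∀ {n} → (Fin (2 * n) → Fin n) → Fin n → (Fin n → Bool)
iP w x y = isℕ (count (λ t → is (w t) y ∧ between w x t)) 1

iPlin : ∀ {n} → (Fin (2 * n) → Fin n) → (Fin n → Bool) → (Fin n → Bool)
iPlin w v y = ⊕sum (λ ℓ → v ℓ ∧ iP w ℓ y)

iP² : ∀ {n} → (Fin (2 * n) → Fin n) → Fin n → (Fin n → Bool)
iP² w x = iPlin w (iP w x)

inO : ∀ {n} → (Fin (2 * n) → Fin n) → Fin n → Bool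
inO w x = ⊕sum (iP w x)

-- Maps (cellularly embedded graphs on closed surfaces) as
-- graph-encoded maps on flags: σ₀ changes the vertex, σ₁ the edge,
-- σ₂ the face of a flag.

record Map (m : ℕ) : Set where
  field
    σ₀ σ₁ σ₂ : Fin m → Fin m
    inv₀ : ∀ f → σ₀ (σ₀ f) ≡ f
    inv₁ : ∀ f → σ₁ (σ₁ f) ≡ f
    inv₂ : ∀ f → σ₂ (σ₂ f) ≡ f
    fpf₀ : ∀ f → σ₀ f ≢ f
    fpf₁ : ∀ f → σ₁ f ≢ f
    fpf₂ : ∀ f → σ₂ f ≢ f
    comm₀₂ : ∀ f → σ₀ (σ₂ f) ≡ σ₂ (σ₀ f)
    fpf₀₂ : ∀ f → σ₀ (σ₂ f) ≢ f
    connected : ∀ f g → Star (λ a b → b ≡ σ₀ a ⊎ b ≡ σ₁ a ⊎ b ≡ σ₂ a) f g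

  -- traversing an edge
  τ : Fin m → Fin m
  τ f = σ₀ (σ₂ f)

  -- one step of a zigzag (Petrie walk): traverse, then turn
  ρ : Fin m → Fin m
  ρ f = σ₁ (τ f)

Orb : ∀ {m} → (Fin m → Fin m) → (Fin m → Fin m) → Fin m → Fin m → Set
Orb a b = Star (λ f g → g ≡ a f ⊎ g ≡ b f)

HasOrbits : ∀ {m} → (Fin m → Fin m) → (Fin m → Fin m) → ℕ → Set
HasOrbits {m} a b k =
  Σ (Fin m → Fin k) λ cls →
    (∀ i → ∃ λ f → cls f ≡ i) × (∀ f g → (cls f ≡ cls g) ⇔ Orb a b f g)

iter : ∀ {A : Set} → (A → A) → ℕ → A → A
iter h zero    x = x
iter h (suc j) x = h (iter h j x)

-- A 2-face colorable realization (lacet) of the Gauss code w, given as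
-- the map M whose (unique) zigzag traverses the edges in the cyclic
-- order w.

record Lacet (n : ℕ) (w : Fin (2 * n) → Fin n) : Set where
  field
    m : ℕ
    M : Map m
  open Map M public
  field
    lab : Fin m → Fin n
    labEdge : ∀ f g → (lab g ≡ lab f) ⇔
                      (g ≡ f ⊎ g ≡ σ₀ f ⊎ g ≡ σ₂ f ⊎ g ≡ σ₀ (σ₂ f))
    f₀ : Fin m
    reads : ∀ (j : Fin (2 * n)) → lab (iter ρ (toℕ j) f₀) ≡ w j
    -- it is the only zigzag: it passes through every flag
    single : ∀ g → ∃ λ (j : Fin (2 * n)) →
               g ≡ iter ρ (toℕ j) f₀ ⊎ g ≡ τ (iter ρ (toℕ j) f₀)

  entry : Fin (2 * n) → Fin m
  entry j = iter ρ (toℕ j) f₀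

  -- edge k is black iff the zigzag traverses it twice in the same
  -- direction, i.e. both traversals enter at the same end of k
  Black : Fin n → Set
  Black k = ∃ λ j → ∃ λ j' → j ≢ j' × w j ≡ k × w j' ≡ k ×
              entry j' ≡ σ₂ (entry j)

  -- numbers of vertices and faces (Euler characteristic V - n + F)
  HasVF : ℕ → ℕ → Set
  HasVF v fc = HasOrbits σ₁ σ₂ v × HasOrbits σ₀ σ₁ fc

  Orientable : Set
  Orientable = Σ (Fin m → Bool) λ c →
    ∀ f → (c (σ₀ f) ≡ not (c f)) × (c (σ₁ f) ≡ not (c f)) × (c (σ₂ f) ≡ not (c f))

  InSphere : Set
  InSphere = ∃ λ v → ∃ λ fc → HasVF v fc × v + fc ≡ n + 2

  InProjectivePlane : Set
  InProjectivePlane = ∃ λ v → ∃ λ fc → HasVF v fc × v + fc ≡ n + 1 × ¬ Orientable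

  InKleinBottle : Set
  InKleinBottle = ∃ λ v → ∃ λ fc → HasVF v fc × v + fc ≡ n × ¬ Orientable

-- The system of equations (coordinate y of the k-th vector equation)

LHS : ∀ {n} → (Fin (2 * n) → Fin n) → (γ : Fin n → Bool) → Fin n → Fin n → Bool
LHS w γ k y = iP² w k y xor (iP w k y ∧ (true xor γ k xor γ y))

RHS : ∀ {n} → (Fin (2 * n) → Fin n) → (δ : Fin n → Bool) → Fin n → Fin n → Bool
RHS w δ k y =
  if inO w k
  then (if inO w y then true xor δ k xor δ y else δ y)
  else (δ k ∧ inO w y)

{-# OPTIONS --safe #-}
-- Let A = i_P and let G be the symmetric matrix of the left-hand sides,
-- G_kℓ = (A²)_kℓ + A_kℓ (1 + γ_k + γ_ℓ); its diagonal is the indicator of 𝒪.  Following the zigzag,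
-- A applied to the coboundary ∂φ of a function φ on the vertices (resp. faces) of M telescopes to γ ∂φ
-- (resp. (1 + γ) ∂φ), and then G ∂φ = 0.  These coboundaries span a subspace of ker G of dimension
-- (V - 1) + (F - 1), so rank G ≤ n + 2 - V - F.  On the sphere G = 0, and δ = 0 works.  On the projective
-- plane and the Klein bottle rank G ≤ 2, and 𝒪 ≠ ∅, because for 𝒪 = ∅ the parity of the position along
-- the zigzag would orient the surface; a symmetric 𝔽₂-matrix of rank ≤ 2 with a nonzero diagonal entry
-- is u uᵀ + h hᵀ, and then δ = h solves the system.
module Submission where

open import Defs
open import Level using (0ℓ)
open import Algebra.Bundles using (CommutativeRing; CommutativeMonoid)
import Algebra.Properties.CommutativeMonoid.Sum as MonoidSum
open import Data.Bool using (Bool; true; false; _xor_; _∧_; not; if_then_else_)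
open import Data.Bool.Properties
  using ( xor-∧-commutativeRing; xor-same; xor-comm; xor-assoc; xor-identityʳ; xor-inverseʳ
        ; xor-annihilates-not; not-involutive; not-distribˡ-xor; ¬-not
        ; ∧-assoc; ∧-comm; ∧-idem; ∧-zeroʳ; ∧-identityʳ; ∧-distribˡ-xor; ∧-distribʳ-xor )
  renaming (_≟_ to _≟ᵇ_)
open import Data.Empty using (⊥; ⊥-elim)
open import Data.Fin using (Fin; zero; suc; toℕ; fromℕ<; punchIn; _↑ˡ_; _↑ʳ_; splitAt)
open import Data.Fin.Properties
  using (_≟_; any?; suc-injective; toℕ-injective; toℕ<n; toℕ-fromℕ<; splitAt⁻¹-↑ˡ; splitAt⁻¹-↑ʳ)
open import Data.Nat using (ℕ; zero; suc; _+_; _*_; _<_; _≤_; _<ᵇ_; s≤s; z≤n)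
open import Data.Nat.Properties as ℕ using (m<n⇒m<1+n; +-0-commutativeMonoid)
open import Data.Product using (∃; ∃₂; _×_; _,_; proj₁; proj₂)
open import Data.Sum using (_⊎_; inj₁; inj₂)
open import Data.Vec.Functional using (_++_; insertAt; removeAt; []; _∷_)
open import Data.Vec.Functional.Properties using (insertAt-lookup; insertAt-punchIn; lookup-++ˡ; lookup-++ʳ)
open import Data.Maybe using (Maybe; just; nothing)
open import Function using (_∘_; _⇔_; case_of_; module Equivalence)
open import Relation.Binary.PropositionalEquality
  using (_≡_; _≢_; _≗_; refl; sym; trans; cong; cong₂; subst; module ≡-Reasoning)
open import Relation.Nullary using (¬_; yes; no)
open import Relation.Binary.Construct.Closure.ReflexiveTransitive using (Star; ε; _◅_)
open import Tactic.RingSolver using (solve-∀)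
open import Data.Nat.Tactic.RingSolver using () renaming (solve-∀ to solve-∀ℕ)
open import Tactic.RingSolver.Core.AlmostCommutativeRing using (AlmostCommutativeRing; fromCommutativeRing)
open import Algebra.Properties.Semiring.Sum (CommutativeRing.semiring xor-∧-commutativeRing)
  using ( sum-syntax; sum-cong-≗; sum-replicate-zero; sum-remove
        ; ∑-distrib-+; ∑-comm; *-distribˡ-sum; *-distribʳ-sum )

open ≡-Reasoning

false≟_ : (x : Bool) → Maybe (false ≡ x)
false≟ false = just refl
false≟ true  = nothing

-- The solver decides equality of coefficients in 𝔽₂ itself, so it also proves identities that need 1 + 1 = 0.
𝔽₂ : AlmostCommutativeRing 0ℓ 0ℓ
𝔽₂ = fromCommutativeRing xor-∧-commutativeRing false≟_

∧-leftComm : ∀ a b c → a ∧ (b ∧ c) ≡ b ∧ (a ∧ c)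
∧-leftComm = solve-∀ 𝔽₂

xor-moveʳ : ∀ {a b c} → a xor b ≡ c → a ≡ b xor c
xor-moveʳ {a} {b} refl = move a b
  where
  move : ∀ a b → a ≡ b xor (a xor b)
  move = solve-∀ 𝔽₂

∧-not-cancel : ∀ g {s} → g ∧ s ≡ not g ∧ s → s ≡ false
∧-not-cancel true  gs≡0 = gs≡0
∧-not-cancel false 0≡s  = sym 0≡s

xor≡false⇒≡ : ∀ {a b} → a xor b ≡ false → a ≡ b
xor≡false⇒≡ {false} {false} _ = refl
xor≡false⇒≡ {true}  {true}  _ = refl

module _ {c ℓ} (M : CommutativeMonoid c ℓ) where
  open CommutativeMonoid M
    using (Carrier; _≈_; _∙_; ∙-cong; ∙-congˡ; identityˡ; identityʳ; comm) renaming (trans to ≈-trans; ε to 0#)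
  open MonoidSum M using () renaming (sum to ∑ᴹ; sum-cong-≋ to ∑ᴹ-cong; sum-replicate-zero to ∑ᴹ-zero)

  sum-support₁ : ∀ {k} (f : Fin k → Carrier) a → (∀ t → t ≢ a → f t ≈ 0#) → ∑ᴹ f ≈ f a
  sum-support₁ {suc k} f zero    f≈0# =
    ≈-trans (∙-congˡ (≈-trans (∑ᴹ-cong (λ t → f≈0# (suc t) λ ())) (∑ᴹ-zero k))) (identityʳ (f zero))
  sum-support₁ {suc k} f (suc a) f≈0# =
    ≈-trans (∙-cong (f≈0# zero λ ()) (sum-support₁ (f ∘ suc) a (λ t t≢a → f≈0# (suc t) (t≢a ∘ suc-injective))))
          (identityˡ (f (suc a)))

  sum-support₂ : ∀ {k} (f : Fin k → Carrier) {a b} → a ≢ b → (∀ t → t ≢ a → t ≢ b → f t ≈ 0#) →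
                 ∑ᴹ f ≈ f a ∙ f b
  sum-support₂ f {zero}  {zero}  a≢b _ = ⊥-elim (a≢b refl)
  sum-support₂ f {zero}  {suc b} _ f≈0# =
    ∙-congˡ (sum-support₁ (f ∘ suc) b (λ t t≢b → f≈0# (suc t) (λ ()) (t≢b ∘ suc-injective)))
  sum-support₂ f {suc a} {zero}  _ f≈0# =
    ≈-trans (∙-congˡ (sum-support₁ (f ∘ suc) a (λ t t≢a → f≈0# (suc t) (t≢a ∘ suc-injective) (λ ()))))
          (comm (f zero) (f (suc a)))
  sum-support₂ f {suc a} {suc b} a≢b f≈0# =
    ≈-trans (∙-cong (f≈0# zero (λ ()) (λ ()))
                  (sum-support₂ (f ∘ suc) (a≢b ∘ cong suc) (λ t t≢a t≢b → f≈0# (suc t) (t≢a ∘ suc-injective) (t≢b ∘ suc-injective))))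
          (identityˡ (f (suc a) ∙ f (suc b)))

⊕-commutativeMonoid : CommutativeMonoid 0ℓ 0ℓ
⊕-commutativeMonoid = CommutativeRing.+-commutativeMonoid xor-∧-commutativeRing

⊕sum≡∑ : ∀ {k} (p : Fin k → Bool) → ⊕sum p ≡ ∑[ i < k ] p i
⊕sum≡∑ {zero}  p = refl
⊕sum≡∑ {suc k} p = cong (p zero xor_) (⊕sum≡∑ (p ∘ suc))

∧-distribˡ-∑ : ∀ {k} a (f : Fin k → Bool) → a ∧ ∑[ i < k ] f i ≡ ∑[ i < k ] (a ∧ f i)
∧-distribˡ-∑ = *-distribˡ-sum

∧-distribʳ-∑ : ∀ {k} a (f : Fin k → Bool) → (∑[ i < k ] f i) ∧ a ≡ ∑[ i < k ] (f i ∧ a)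
∧-distribʳ-∑ = *-distribʳ-sum

∑-zero : ∀ {k} (p : Fin k → Bool) → (∀ i → p i ≡ false) → ∑[ i < k ] p i ≡ false
∑-zero {k} p p≗0 = trans (sum-cong-≗ p≗0) (sum-replicate-zero k)

⊕sum-cong : ∀ {k} {f g : Fin k → Bool} → f ≗ g → ⊕sum f ≡ ⊕sum g
⊕sum-cong {f = f} {g} f≗g = trans (⊕sum≡∑ f) (trans (sum-cong-≗ f≗g) (sym (⊕sum≡∑ g)))

-- Linear algebra over 𝔽₂

_*ᵥ_ : ∀ {k n} → (Fin k → Fin n → Bool) → (Fin n → Bool) → Fin k → Bool
(M *ᵥ z) i = ∑[ j < _ ] (M i j ∧ z j)

lincomb : ∀ {K n} → (Fin K → Bool) → (Fin K → Fin n → Bool) → Fin n → Bool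
lincomb c v y = ∑[ i < _ ] (c i ∧ v i y)

Nonzero : ∀ {K} → (Fin K → Bool) → Set
Nonzero c = ∃ λ i → c i ≡ true

Dependent : ∀ {K n} → (Fin K → Fin n → Bool) → Set
Dependent v = ∃ λ c → Nonzero c × (∀ y → lincomb c v y ≡ false)

Independent : ∀ {K n} → (Fin K → Fin n → Bool) → Set
Independent v = ¬ Dependent v

Symmetric : ∀ {n} → (Fin n → Fin n → Bool) → Set
Symmetric S = ∀ k y → S k y ≡ S y k

nonzero? : ∀ {K} (c : Fin K → Bool) → Nonzero c ⊎ (∀ i → c i ≡ false)
nonzero? c with any? (λ i → c i ≟ᵇ true)
... | yes c≢0 = inj₁ c≢0
... | no  c≡0 = inj₂ (λ i → ¬-not (c≡0 ∘ (i ,_)))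

*ᵥ-cong : ∀ {k n} (M : Fin k → Fin n → Bool) {z z′} → z ≗ z′ → M *ᵥ z ≗ M *ᵥ z′
*ᵥ-cong M z≗z′ i = sum-cong-≗ (λ j → cong (M i j ∧_) (z≗z′ j))

*ᵥ-xor : ∀ {k n} (M : Fin k → Fin n → Bool) z z′ i →
         (M *ᵥ (λ j → z j xor z′ j)) i ≡ (M *ᵥ z) i xor (M *ᵥ z′) i
*ᵥ-xor M z z′ i = trans (sum-cong-≗ (λ j → ∧-distribˡ-xor (M i j) (z j) (z′ j)))
                        (∑-distrib-+ (λ j → M i j ∧ z j) (λ j → M i j ∧ z′ j))

*ᵥ-lincomb : ∀ {k n K} (M : Fin k → Fin n → Bool) c (v : Fin K → Fin n → Bool) →
             M *ᵥ lincomb c v ≗ lincomb c (λ l → M *ᵥ v l)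
*ᵥ-lincomb {n = n} {K} M c v i = begin
  ∑[ j < n ] (M i j ∧ ∑[ l < K ] (c l ∧ v l j))  ≡⟨ sum-cong-≗ (λ j → ∧-distribˡ-∑ (M i j) (λ l → c l ∧ v l j)) ⟩
  ∑[ j < n ] ∑[ l < K ] (M i j ∧ (c l ∧ v l j))  ≡⟨ ∑-comm (λ j l → M i j ∧ (c l ∧ v l j)) ⟩
  ∑[ l < K ] ∑[ j < n ] (M i j ∧ (c l ∧ v l j))  ≡⟨ sum-cong-≗ (λ l → sum-cong-≗ (λ j → ∧-leftComm (M i j) (c l) (v l j))) ⟩
  ∑[ l < K ] ∑[ j < n ] (c l ∧ (M i j ∧ v l j))  ≡⟨ sum-cong-≗ (λ l → ∧-distribˡ-∑ (c l) (λ j → M i j ∧ v l j)) ⟨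
  ∑[ l < K ] (c l ∧ ∑[ j < n ] (M i j ∧ v l j))  ∎

*ᵥ-*ᵥ : ∀ {k l n} (M : Fin k → Fin l → Bool) (N : Fin l → Fin n → Bool) z i →
        ∑[ j < n ] (∑[ r < l ] (M i r ∧ N r j) ∧ z j) ≡ (M *ᵥ (N *ᵥ z)) i
*ᵥ-*ᵥ {l = l} {n} M N z i = begin
  ∑[ j < n ] (∑[ r < l ] (M i r ∧ N r j) ∧ z j)  ≡⟨ sum-cong-≗ (λ j → ∧-distribʳ-∑ (z j) (λ r → M i r ∧ N r j)) ⟩
  ∑[ j < n ] ∑[ r < l ] ((M i r ∧ N r j) ∧ z j)  ≡⟨ ∑-comm (λ j r → (M i r ∧ N r j) ∧ z j) ⟩
  ∑[ r < l ] ∑[ j < n ] ((M i r ∧ N r j) ∧ z j)  ≡⟨ sum-cong-≗ (λ r → sum-cong-≗ (λ j → ∧-assoc (M i r) (N r j) (z j))) ⟩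
  ∑[ r < l ] ∑[ j < n ] (M i r ∧ (N r j ∧ z j))  ≡⟨ sum-cong-≗ (λ r → ∧-distribˡ-∑ (M i r) (λ j → N r j ∧ z j)) ⟨
  ∑[ r < l ] (M i r ∧ ∑[ j < n ] (N r j ∧ z j))  ∎

lincomb-insertAt : ∀ {K n} (c : Fin K → Bool) p s (v : Fin (suc K) → Fin n → Bool) y →
                   lincomb (insertAt c p s) v y ≡ (s ∧ v p y) xor lincomb c (removeAt v p) y
lincomb-insertAt {K} c p s v y = begin
  lincomb (insertAt c p s) v y
    ≡⟨ sum-remove {i = p} (λ i → insertAt c p s i ∧ v i y) ⟩
  (insertAt c p s p ∧ v p y) xor ∑[ j < K ] (insertAt c p s (punchIn p j) ∧ v (punchIn p j) y)
    ≡⟨ cong₂ (λ a b → (a ∧ v p y) xor b) (insertAt-lookup c p s)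
             (sum-cong-≗ (λ j → cong (_∧ v (punchIn p j) y) (insertAt-punchIn c p s j))) ⟩
  (s ∧ v p y) xor lincomb c (removeAt v p) y
    ∎

lincomb-eliminate : ∀ {K n} (c : Fin K → Bool) (u u′ : Fin K → Fin n → Bool) (b : Fin n → Bool) y →
  lincomb c (λ j y → u j y xor (u′ j y ∧ b y)) y ≡ lincomb c u y xor (lincomb c u′ y ∧ b y)
lincomb-eliminate {K} c u u′ b y = begin
  ∑[ j < K ] (c j ∧ (u j y xor (u′ j y ∧ b y)))
    ≡⟨ sum-cong-≗ (λ j → ∧-distribˡ-xor (c j) (u j y) _) ⟩
  ∑[ j < K ] ((c j ∧ u j y) xor (c j ∧ (u′ j y ∧ b y)))
    ≡⟨ ∑-distrib-+ (λ j → c j ∧ u j y) _ ⟩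
  lincomb c u y xor ∑[ j < K ] (c j ∧ (u′ j y ∧ b y))
    ≡⟨ cong (lincomb c u y xor_) (trans (sum-cong-≗ (λ j → ∧-assoc′ (c j) (u′ j y) (b y)))
                                        (sym (∧-distribʳ-∑ (b y) (λ j → c j ∧ u′ j y)))) ⟩
  lincomb c u y xor (lincomb c u′ y ∧ b y)
    ∎
  where
  ∧-assoc′ : ∀ a b c → a ∧ (b ∧ c) ≡ (a ∧ b) ∧ c
  ∧-assoc′ = solve-∀ 𝔽₂

-- Gaussian elimination on the first coordinate.
dependent-if-more-than-dim : ∀ {n K} → n < K → (v : Fin K → Fin n → Bool) → Dependent v
dependent-if-more-than-dim {zero} {suc K} _ v = (λ _ → true) , (zero , refl) , λ ()
dependent-if-more-than-dim {suc n} {suc K} (s≤s n<K) v with nonzero? (λ i → v i zero)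
... | inj₂ no-pivot =
  let c , c≢0 , c·v≡0 = dependent-if-more-than-dim (m<n⇒m<1+n n<K) (λ i y → v i (suc y))
      v₀≡0 : ∀ i → c i ∧ v i zero ≡ false
      v₀≡0 i = trans (cong (c i ∧_) (no-pivot i)) (∧-zeroʳ (c i))
  in c , c≢0 , λ { zero → ∑-zero _ v₀≡0 ; (suc y) → c·v≡0 y }
... | inj₁ (p , pivot) =
  insertAt c p s , (punchIn p j , trans (insertAt-punchIn c p s j) cj) , c·v≡0
  where
  v′ : Fin K → Fin (suc n) → Bool
  v′ = removeAt v p
  reduced : Fin K → Fin n → Bool
  reduced j y = v′ j (suc y) xor (v′ j zero ∧ v p (suc y))
  IH = dependent-if-more-than-dim n<K reduced
  c = proj₁ IH
  j = proj₁ (proj₁ (proj₂ IH))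
  cj = proj₂ (proj₁ (proj₂ IH))
  s = lincomb c v′ zero
  c·v≡0 : ∀ y → lincomb (insertAt c p s) v y ≡ false
  c·v≡0 zero = begin
    lincomb (insertAt c p s) v zero  ≡⟨ lincomb-insertAt c p s v zero ⟩
    (s ∧ v p zero) xor s             ≡⟨ cong (λ b → (s ∧ b) xor s) pivot ⟩
    (s ∧ true) xor s                 ≡⟨ cong (_xor s) (∧-identityʳ s) ⟩
    s xor s                          ≡⟨ xor-same s ⟩
    false                            ∎
  c·v≡0 (suc y) = begin
    lincomb (insertAt c p s) v (suc y)
      ≡⟨ lincomb-insertAt c p s v (suc y) ⟩
    (s ∧ v p (suc y)) xor lincomb c v′ (suc y)
      ≡⟨ xor-comm (s ∧ v p (suc y)) (lincomb c v′ (suc y)) ⟩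
    lincomb c v′ (suc y) xor (s ∧ v p (suc y))
      ≡⟨ lincomb-eliminate c (λ j y → v′ j (suc y)) (λ j _ → v′ j zero) (v p ∘ suc) y ⟨
    lincomb c reduced y
      ≡⟨ proj₂ (proj₂ IH) y ⟩
    false
      ∎

∑-↑ : ∀ {a b} (f : Fin (a + b) → Bool) →
      ∑[ t < a + b ] f t ≡ ∑[ i < a ] f (i ↑ˡ b) xor ∑[ j < b ] f (a ↑ʳ j)
∑-↑ {zero}  f = refl
∑-↑ {suc a} {b} f = trans (cong (f zero xor_) (∑-↑ {a} {b} (f ∘ suc))) (sym (xor-assoc (f zero) _ _))

lincomb-++ : ∀ {a b n} c (u : Fin a → Fin n → Bool) (v : Fin b → Fin n → Bool) y →
             lincomb c (u ++ v) y ≡ lincomb (c ∘ (_↑ˡ b)) u y xor lincomb (c ∘ (a ↑ʳ_)) v y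
lincomb-++ {a} {b} c u v y = trans (∑-↑ {a} {b} (λ t → c t ∧ (u ++ v) t y)) (cong₂ _xor_
  (sum-cong-≗ (λ i → cong (λ x → c (i ↑ˡ b) ∧ x y) (lookup-++ˡ u v i)))
  (sum-cong-≗ (λ j → cong (λ x → c (a ↑ʳ j) ∧ x y) (lookup-++ʳ u v j))))

nonzero-↑ : ∀ {a b} {c : Fin (a + b) → Bool} → Nonzero c → Nonzero (c ∘ (_↑ˡ b)) ⊎ Nonzero (c ∘ (a ↑ʳ_))
nonzero-↑ {a} {c = c} (i , ci) with splitAt a i in eq
... | inj₁ j = inj₁ (j , trans (cong c (splitAt⁻¹-↑ˡ eq)) ci)
... | inj₂ j = inj₂ (j , trans (cong c (splitAt⁻¹-↑ʳ eq)) ci)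

-- Rank–nullity: an independent family of size a inside the kernel of M bounds the rank of M by n ∸ a.
image-dependent : ∀ {k n a K} (M : Fin k → Fin n → Bool) (u : Fin a → Fin n → Bool) →
                  Independent u → (∀ i j → (M *ᵥ u i) j ≡ false) → n < a + K →
                  (x : Fin K → Fin n → Bool) → Dependent (λ i → M *ᵥ x i)
image-dependent {a = a} {K} M u u-indep Mu≡0 n<a+K x with dependent-if-more-than-dim n<a+K (u ++ x)
... | d , d≢0 , d·ux≡0 = d₂ , d₂≢0 (nonzero? d₂) , Md₂x≡0
  where
  d₁ = d ∘ (_↑ˡ K)
  d₂ = d ∘ (a ↑ʳ_)
  d₁u≡d₂x : ∀ y → lincomb d₁ u y ≡ lincomb d₂ x y
  d₁u≡d₂x y = xor≡false⇒≡ (trans (sym (lincomb-++ d u x y)) (d·ux≡0 y))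
  d₂≢0 : Nonzero d₂ ⊎ (∀ i → d₂ i ≡ false) → Nonzero d₂
  d₂≢0 (inj₁ d₂≢0) = d₂≢0
  d₂≢0 (inj₂ d₂≡0) with nonzero-↑ {a} d≢0
  ... | inj₂ d₂≢0 = d₂≢0
  ... | inj₁ d₁≢0 = ⊥-elim (u-indep (d₁ , d₁≢0 , λ y → trans (d₁u≡d₂x y) (∑-zero _ (λ i → cong (_∧ x i y) (d₂≡0 i)))))
  Md₂x≡0 : ∀ j → lincomb d₂ (λ i → M *ᵥ x i) j ≡ false
  Md₂x≡0 j = begin
    lincomb d₂ (λ i → M *ᵥ x i) j  ≡⟨ *ᵥ-lincomb M d₂ x j ⟨
    (M *ᵥ lincomb d₂ x) j          ≡⟨ *ᵥ-cong M (λ y → sym (d₁u≡d₂x y)) j ⟩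
    (M *ᵥ lincomb d₁ u) j          ≡⟨ *ᵥ-lincomb M d₁ u j ⟩
    lincomb d₁ (λ i → M *ᵥ u i) j  ≡⟨ ∑-zero _ (λ i → trans (cong (d₁ i ∧_) (Mu≡0 i j)) (∧-zeroʳ (d₁ i))) ⟩
    false                          ∎

dependent-cong : ∀ {K n} {v v′ : Fin K → Fin n → Bool} → (∀ i y → v i y ≡ v′ i y) → Dependent v → Dependent v′
dependent-cong v≡v′ (c , c≢0 , c·v≡0) =
  c , c≢0 , λ y → trans (sum-cong-≗ (λ i → cong (c i ∧_) (sym (v≡v′ i y)))) (c·v≡0 y)

dependent-single : ∀ {n} {v : Fin n → Bool} → Dependent (λ (_ : Fin 1) → v) → ∀ y → v y ≡ false
dependent-single {v = v} (c , (zero , c₀) , c·v≡0) y =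
  trans (sym (xor-identityʳ (v y))) (subst (λ b → (b ∧ v y) xor false ≡ false) c₀ (c·v≡0 y))

pair-dependent : ∀ {n} c₁ c₂ (a b : Fin n → Bool) → c₁ ≡ true ⊎ c₂ ≡ true →
                 (∀ k → (c₁ ∧ a k) xor (c₂ ∧ b k) ≡ false) →
                 (∀ k → a k ≡ false) ⊎ (∀ k → b k ≡ false) ⊎ a ≗ b
pair-dependent true  false a b _ ab≡0 = inj₁ (λ k → trans (sym (xor-identityʳ (a k))) (ab≡0 k))
pair-dependent false true  a b _ ab≡0 = inj₂ (inj₁ ab≡0)
pair-dependent true  true  a b _ ab≡0 = inj₂ (inj₂ (λ k → xor≡false⇒≡ (ab≡0 k)))
pair-dependent false false a b (inj₁ ()) _
pair-dependent false false a b (inj₂ ()) _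

col : ∀ {n} → (Fin n → Fin n → Bool) → Fin n → Fin n → Bool
col S y k = S k y

symmetric-rank≤1 : ∀ {n} (S : Fin n → Fin n → Bool) → Symmetric S →
  (∀ y y′ → (∀ k → S k y ≡ false) ⊎ (∀ k → S k y′ ≡ false) ⊎ col S y ≗ col S y′) →
  ∃ λ h → ∀ k y → S k y ≡ h k ∧ h y
symmetric-rank≤1 S S-sym pair with nonzero? (λ k → S k k)
... | inj₁ (k₁ , Sk₁k₁≡1) = col S k₁ , λ k y → through-k₁ k y (pair y k₁)
  where
  through-k₁ : ∀ k y → (∀ k → S k y ≡ false) ⊎ (∀ k → S k k₁ ≡ false) ⊎ col S y ≗ col S k₁ →
               S k y ≡ S k k₁ ∧ S y k₁
  through-k₁ k y (inj₁ Sy≡0) = begin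
    S k y            ≡⟨ Sy≡0 k ⟩
    false            ≡⟨ ∧-zeroʳ (S k k₁) ⟨
    S k k₁ ∧ false   ≡⟨ cong (S k k₁ ∧_) (trans (S-sym y k₁) (Sy≡0 k₁)) ⟨
    S k k₁ ∧ S y k₁  ∎
  through-k₁ k y (inj₂ (inj₁ Sk₁≡0)) with () ← trans (sym Sk₁k₁≡1) (Sk₁≡0 k₁)
  through-k₁ k y (inj₂ (inj₂ Sy≡Sk₁)) = begin
    S k y            ≡⟨ Sy≡Sk₁ k ⟩
    S k k₁           ≡⟨ ∧-identityʳ (S k k₁) ⟨
    S k k₁ ∧ true    ≡⟨ cong (S k k₁ ∧_) (trans (S-sym y k₁) (trans (Sy≡Sk₁ k₁) Sk₁k₁≡1)) ⟨
    S k k₁ ∧ S y k₁  ∎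
... | inj₂ zero-diagonal = (λ _ → false) , λ k y → vanish k y (pair y k)
  where
  vanish : ∀ k y → (∀ k → S k y ≡ false) ⊎ (∀ l → S l k ≡ false) ⊎ col S y ≗ col S k → S k y ≡ false
  vanish k y (inj₁ Sy≡0)          = Sy≡0 k
  vanish k y (inj₂ (inj₁ Sk≡0))   = trans (S-sym k y) (Sk≡0 y)
  vanish k y (inj₂ (inj₂ Sy≡Sk))  = trans (Sy≡Sk k) (zero-diagonal k)

tail-nonzero : ∀ {c : Fin 3 → Bool} {a b} → Nonzero c →
               (c zero ∧ true) xor ((c (suc zero) ∧ a) xor ((c (suc (suc zero)) ∧ b) xor false)) ≡ false →
               c (suc zero) ≡ true ⊎ c (suc (suc zero)) ≡ true
tail-nonzero {c} (i , cᵢ≡1) scalar≡0 with c zero in c₀ | c (suc zero) in c₁ | c (suc (suc zero)) in c₂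
... | _     | true  | _     = inj₁ refl
... | _     | false | true  = inj₂ refl
... | true  | false | false with () ← scalar≡0
... | false | false | false with i
...   | zero           with () ← trans (sym cᵢ≡1) c₀
...   | suc zero       with () ← trans (sym cᵢ≡1) c₁
...   | suc (suc zero) with () ← trans (sym cᵢ≡1) c₂

-- G is split as u uᵀ + H with u the column of a nonzero diagonal entry k₀; the k₀-coordinate of a
-- dependence between three columns of G shows that the remaining two columns of H are dependent.
symmetric-rank≤2 : ∀ {n} (G : Fin n → Fin n → Bool) → Symmetric G → ∀ k₀ → G k₀ k₀ ≡ true →
  (∀ y y′ → Dependent (col G k₀ ∷ col G y ∷ col G y′ ∷ [])) →
  ∃₂ λ (u h : Fin n → Bool) → ∀ k y → G k y ≡ (u k ∧ u y) xor (h k ∧ h y)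
symmetric-rank≤2 G G-sym k₀ Gk₀k₀≡1 dep =
  let h , H≡hhᵀ = symmetric-rank≤1 H H-sym H-pairs in
  u , h , λ k y → xor-moveʳ (H≡hhᵀ k y)
  where
  u : Fin _ → Bool
  u = col G k₀
  H : Fin _ → Fin _ → Bool
  H k y = G k y xor (u k ∧ u y)
  H-sym : Symmetric H
  H-sym k y = cong₂ _xor_ (G-sym k y) (∧-comm (u k) (u y))
  split : ∀ c₀ c₁ c₂ uk gy gy′ uy uy′ →
    (c₁ ∧ (gy xor (uk ∧ uy))) xor (c₂ ∧ (gy′ xor (uk ∧ uy′)))
      ≡ ((c₀ ∧ uk) xor ((c₁ ∧ gy) xor ((c₂ ∧ gy′) xor false)))
        xor (uk ∧ ((c₀ ∧ true) xor ((c₁ ∧ uy) xor ((c₂ ∧ uy′) xor false))))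
  split = solve-∀ 𝔽₂
  H-pairs : ∀ y y′ → (∀ k → H k y ≡ false) ⊎ (∀ k → H k y′ ≡ false) ⊎ col H y ≗ col H y′
  H-pairs y y′ with dep y y′
  ... | c , c≢0 , c·G≡0 =
    pair-dependent (c (suc zero)) (c (suc (suc zero))) (col H y) (col H y′) (tail-nonzero c≢0 scalar≡0) cH≡0
    where
    combo : Bool → Bool → Bool → Bool
    combo a b d = (c zero ∧ a) xor ((c (suc zero) ∧ b) xor ((c (suc (suc zero)) ∧ d) xor false))
    scalar≡0 : combo true (u y) (u y′) ≡ false
    scalar≡0 = trans (cong₂ (λ a b → combo a b (u y′)) (sym Gk₀k₀≡1) (G-sym y k₀))
                     (trans (cong (combo (G k₀ k₀) (G k₀ y)) (G-sym y′ k₀)) (c·G≡0 k₀))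
    cH≡0 : ∀ k → (c (suc zero) ∧ H k y) xor (c (suc (suc zero)) ∧ H k y′) ≡ false
    cH≡0 k = trans (split (c zero) (c (suc zero)) (c (suc (suc zero))) (u k) (G k y) (G k y′) (u y) (u y′))
                   (trans (cong₂ (λ a b → a xor (u k ∧ b)) (c·G≡0 k) scalar≡0) (∧-zeroʳ (u k)))

is-refl : ∀ {k} (x : Fin k) → is x x ≡ true
is-refl x with x ≟ x
... | yes _  = refl
... | no x≢x = ⊥-elim (x≢x refl)

is-≢ : ∀ {k} {x y : Fin k} → x ≢ y → is x y ≡ false
is-≢ {x = x} {y} x≢y with x ≟ y
... | yes x≡y = ⊥-elim (x≢y x≡y)
... | no _    = refl

is⇒≡ : ∀ {k} {x y : Fin k} → is x y ≡ true → x ≡ y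
is⇒≡ {x = x} {y} _ with x ≟ y
is⇒≡ _  | yes x≡y = x≡y
is⇒≡ () | no _

*ᵥ-unit : ∀ {k n} (M : Fin k → Fin n → Bool) y i → (M *ᵥ (λ j → is j y)) i ≡ M i y
*ᵥ-unit M y i = trans (sum-support₁ ⊕-commutativeMonoid (λ j → M i j ∧ is j y) y
                          (λ j j≢y → trans (cong (M i j ∧_) (is-≢ j≢y)) (∧-zeroʳ (M i j))))
                        (trans (cong (M i y ∧_) (is-refl y)) (∧-identityʳ (M i y)))

[_] : Bool → ℕ
[ b ] = if b then 1 else 0

count≡∑ : ∀ {k} (p : Fin k → Bool) → count p ≡ MonoidSum.sum +-0-commutativeMonoid (λ t → [ p t ])
count≡∑ {zero}  p = refl
count≡∑ {suc k} p = cong ([ p zero ] +_) (count≡∑ (p ∘ suc))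

count-support₂ : ∀ {k} (p : Fin k → Bool) {a b} → a ≢ b → (∀ t → t ≢ a → t ≢ b → p t ≡ false) →
                 count p ≡ [ p a ] + [ p b ]
count-support₂ p a≢b p≡0 = trans (count≡∑ p)
  (sum-support₂ +-0-commutativeMonoid (λ t → [ p t ]) a≢b (λ t t≢a t≢b → cong [_] (p≡0 t t≢a t≢b)))

isℕ-[]+[] : ∀ a b → isℕ ([ a ] + [ b ]) 1 ≡ a xor b
isℕ-[]+[] false false = refl
isℕ-[]+[] false true  = refl
isℕ-[]+[] true  false = refl
isℕ-[]+[] true  true  = refl

count≡0⇒ : ∀ {k} (p : Fin k → Bool) → count p ≡ 0 → ∀ t → p t ≡ false
count≡0⇒ {suc k} p count≡0 t with p zero in p₀
count≡0⇒ {suc k} p ()      t       | true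
count≡0⇒ {suc k} p count≡0 zero    | false = p₀
count≡0⇒ {suc k} p count≡0 (suc t) | false = count≡0⇒ (p ∘ suc) count≡0 t

count≡1⇒ : ∀ {k} (p : Fin k → Bool) → count p ≡ 1 → ∃ λ a → p a ≡ true × (∀ t → t ≢ a → p t ≡ false)
count≡1⇒ {suc k} p count≡1 with p zero in p₀
... | true  = zero , p₀ , λ { zero 0≢0 → ⊥-elim (0≢0 refl)
                            ; (suc t) _ → count≡0⇒ (p ∘ suc) (ℕ.suc-injective count≡1) t }
... | false = let a , pa , elsewhere = count≡1⇒ (p ∘ suc) count≡1 in
              suc a , pa , λ { zero _ → p₀ ; (suc t) t≢a → elsewhere t (t≢a ∘ cong suc) }

record ExactlyTwo {k} (p : Fin k → Bool) : Set where
  field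
    fst snd   : Fin k
    fst<snd   : toℕ fst < toℕ snd
    fst-holds : p fst ≡ true
    snd-holds : p snd ≡ true
    elsewhere : ∀ t → t ≢ fst → t ≢ snd → p t ≡ false

count≡2⇒ : ∀ {k} (p : Fin k → Bool) → count p ≡ 2 → ExactlyTwo p
count≡2⇒ {suc k} p count≡2 with p zero in p₀
... | true = let b , pb , elsewhere = count≡1⇒ (p ∘ suc) (ℕ.suc-injective count≡2) in record
  { fst = zero ; snd = suc b ; fst<snd = s≤s z≤n ; fst-holds = p₀ ; snd-holds = pb
  ; elsewhere = λ { zero 0≢0 _ → ⊥-elim (0≢0 refl) ; (suc t) _ t≢b → elsewhere t (t≢b ∘ cong suc) } }
... | false = later-two p₀ (count≡2⇒ (p ∘ suc) count≡2)
  where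
  later-two : p zero ≡ false → ExactlyTwo (p ∘ suc) → ExactlyTwo p
  later-two p₀ two = record
    { fst = suc fst ; snd = suc snd ; fst<snd = s≤s fst<snd ; fst-holds = fst-holds ; snd-holds = snd-holds
    ; elsewhere = λ { zero _ _ → p₀ ; (suc t) t≢a t≢b → elsewhere t (t≢a ∘ cong suc) (t≢b ∘ cong suc) } }
    where open ExactlyTwo two

<ᵇ-true : ∀ {m n} → m < n → (m <ᵇ n) ≡ true
<ᵇ-true (s≤s z≤n)       = refl
<ᵇ-true (s≤s (s≤s m<n)) = <ᵇ-true (s≤s m<n)

<ᵇ-false : ∀ {m n} → n ≤ m → (m <ᵇ n) ≡ false
<ᵇ-false z≤n       = refl
<ᵇ-false (s≤s n≤m) = <ᵇ-false n≤m

last-index : ∀ {t N} → t < N → ∃ λ N′ → suc N′ ≡ N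
last-index (s≤s _) = _ , refl

odd : ℕ → Bool
odd zero    = false
odd (suc t) = not (odd t)

odd-+ : ∀ s t → odd (s + t) ≡ odd s xor odd t
odd-+ zero    t = refl
odd-+ (suc s) t = trans (cong not (odd-+ s t)) (not-distribˡ-xor (odd s) (odd t))

∑-telescope : ∀ N b (q : ℕ → Bool) → b ≤ N →
              ∑[ t < N ] ((toℕ t <ᵇ b) ∧ (q (toℕ t) xor q (suc (toℕ t)))) ≡ q 0 xor q b
∑-telescope N       zero    q _ = trans (∑-zero {N} _ (λ _ → refl)) (sym (xor-same (q 0)))
∑-telescope (suc N) (suc b) q (s≤s b≤N) = begin
  (q 0 xor q 1) xor ∑[ t < N ] ((toℕ t <ᵇ b) ∧ (q (suc (toℕ t)) xor q (suc (suc (toℕ t)))))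
    ≡⟨ cong ((q 0 xor q 1) xor_) (∑-telescope N b (q ∘ suc) b≤N) ⟩
  (q 0 xor q 1) xor (q 1 xor q (suc b))
    ≡⟨ cancel (q 0) (q 1) (q (suc b)) ⟩
  q 0 xor q (suc b)
    ∎
  where
  cancel : ∀ a b c → (a xor b) xor (b xor c) ≡ a xor c
  cancel = solve-∀ 𝔽₂

<ᵇ-suc : ∀ a x → (a <ᵇ x) ≡ not (x <ᵇ suc a)
<ᵇ-suc zero    zero    = refl
<ᵇ-suc zero    (suc x) = refl
<ᵇ-suc (suc a) zero    = refl
<ᵇ-suc (suc a) (suc x) = <ᵇ-suc a x

<ᵇ-suc-≢ : ∀ {x a} → x ≢ a → (x <ᵇ suc a) ≡ (x <ᵇ a)
<ᵇ-suc-≢ {zero}  {zero}  0≢0 = ⊥-elim (0≢0 refl)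
<ᵇ-suc-≢ {zero}  {suc a} _   = refl
<ᵇ-suc-≢ {suc x} {zero}  _   = refl
<ᵇ-suc-≢ {suc x} {suc a} x≢a = <ᵇ-suc-≢ (x≢a ∘ cong suc)

<ᵇ-flip : ∀ {x y} → x ≢ y → (y <ᵇ x) ≡ not (x <ᵇ y)
<ᵇ-flip {x} {y} x≢y = trans (<ᵇ-suc y x) (cong not (<ᵇ-suc-≢ x≢y))

-- Parity of the number of pairs (x , y) with x ∈ {c , d}, y ∈ {a , b} and x < y.
crossings : ℕ → ℕ → ℕ → ℕ → Bool
crossings a b c d = ((c <ᵇ b) xor (c <ᵇ a)) xor ((d <ᵇ b) xor (d <ᵇ a))

-- Exchanging the two sets negates each of the four comparisons, and four negations cancel.
crossings-sym : ∀ {a b c d} → a ≢ c → a ≢ d → b ≢ c → b ≢ d → crossings a b c d ≡ crossings c d a b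
crossings-sym {a} {b} {c} {d} a≢c a≢d b≢c b≢d = begin
  ((c <ᵇ b) xor (c <ᵇ a)) xor ((d <ᵇ b) xor (d <ᵇ a))
    ≡⟨ cong₂ _xor_ (cong₂ _xor_ (<ᵇ-flip b≢c) (<ᵇ-flip a≢c)) (cong₂ _xor_ (<ᵇ-flip b≢d) (<ᵇ-flip a≢d)) ⟩
  (not (b <ᵇ c) xor not (a <ᵇ c)) xor (not (b <ᵇ d) xor not (a <ᵇ d))
    ≡⟨ four-nots (b <ᵇ c) (a <ᵇ c) (b <ᵇ d) (a <ᵇ d) ⟩
  ((a <ᵇ d) xor (a <ᵇ c)) xor ((b <ᵇ d) xor (b <ᵇ c))
    ∎
  where
  four-nots : ∀ p q r s → ((true xor p) xor (true xor q)) xor ((true xor r) xor (true xor s)) ≡ (s xor q) xor (r xor p)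
  four-nots = solve-∀ 𝔽₂

-- Gauss codes and the interlacement map i_P

module GaussCode {n} (w : Fin (2 * n) → Fin n) (gauss : IsGaussCode w) where

  private
    module Occ k = ExactlyTwo (count≡2⇒ (λ t → is (w t) k) (gauss k))

  first second : Fin n → Fin (2 * n)
  first  = Occ.fst
  second = Occ.snd

  first<second : ∀ k → toℕ (first k) < toℕ (second k)
  first<second = Occ.fst<snd

  w-first : ∀ k → w (first k) ≡ k
  w-first k = is⇒≡ (Occ.fst-holds k)

  w-second : ∀ k → w (second k) ≡ k
  w-second k = is⇒≡ (Occ.snd-holds k)

  first≢second : ∀ k → first k ≢ second k
  first≢second k eq = ℕ.<-irrefl (cong toℕ eq) (first<second k)

  occurrence : ∀ {k t} → w t ≡ k → t ≡ first k ⊎ t ≡ second k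
  occurrence {k} {t} wt≡k with t ≟ first k | t ≟ second k
  ... | yes t≡a | _       = inj₁ t≡a
  ... | no _    | yes t≡b = inj₂ t≡b
  ... | no t≢a  | no t≢b  with () ← trans (sym (Occ.elsewhere k t t≢a t≢b)) (trans (cong (λ x → is x k) wt≡k) (is-refl k))

  positions-distinct : ∀ {k y s t} → k ≢ y → w s ≡ k → w t ≡ y → toℕ s ≢ toℕ t
  positions-distinct k≢y ws≡k wt≡y s≡t = k≢y (trans (sym ws≡k) (trans (cong w (toℕ-injective s≡t)) wt≡y))

  between-endpoint : ∀ {k t} → w t ≡ k → between w k t ≡ false
  between-endpoint {k} {t} wt≡k =
    trans (cong (λ b → isℕ (before w k t) 1 ∧ not b) (trans (cong (λ x → is x k) wt≡k) (is-refl k)))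
          (∧-zeroʳ (isℕ (before w k t) 1))

  before-occurrences : ∀ k t → before w k t ≡ [ toℕ (first k) <ᵇ toℕ t ] + [ toℕ (second k) <ᵇ toℕ t ]
  before-occurrences k t = begin
    count (λ s → (toℕ s <ᵇ toℕ t) ∧ is (w s) k)
      ≡⟨ count-support₂ _ (first≢second k) (λ s s≢a s≢b → trans (cong (_ ∧_) (Occ.elsewhere k s s≢a s≢b)) (∧-zeroʳ _)) ⟩
    [ (toℕ (first k) <ᵇ toℕ t) ∧ is (w (first k)) k ] + [ (toℕ (second k) <ᵇ toℕ t) ∧ is (w (second k)) k ]
      ≡⟨ cong₂ (λ p q → [ p ] + [ q ]) (holds (toℕ (first k) <ᵇ toℕ t) (Occ.fst-holds k)) (holds (toℕ (second k) <ᵇ toℕ t) (Occ.snd-holds k)) ⟩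
    [ toℕ (first k) <ᵇ toℕ t ] + [ toℕ (second k) <ᵇ toℕ t ]
      ∎
    where
    holds : ∀ p {q} → q ≡ true → p ∧ q ≡ p
    holds p refl = ∧-identityʳ p

  -- The positions strictly between the occurrences of k: before the second one, but not up to the first one.
  between-xor : ∀ k t → between w k t ≡ (toℕ t <ᵇ toℕ (second k)) xor (toℕ t <ᵇ suc (toℕ (first k)))
  between-xor k t with t ≟ first k | t ≟ second k
  ... | yes refl | _ = trans (between-endpoint (w-first k))
      (sym (trans (cong (_xor (toℕ t <ᵇ suc (toℕ t))) (<ᵇ-true (first<second k)))
                  (cong not (<ᵇ-true (ℕ.n<1+n (toℕ t))))))
  ... | no _ | yes refl = trans (between-endpoint (w-second k))
      (sym (cong₂ _xor_ (<ᵇ-false {toℕ t} ℕ.≤-refl) (<ᵇ-false (first<second k))))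
  ... | no t≢a | no t≢b = begin
    isℕ (before w k t) 1 ∧ not (is (w t) k)
      ≡⟨ cong₂ (λ c b → isℕ c 1 ∧ not b) (before-occurrences k t) (Occ.elsewhere k t t≢a t≢b) ⟩
    isℕ ([ a <ᵇ x ] + [ b <ᵇ x ]) 1 ∧ true
      ≡⟨ trans (∧-identityʳ _) (isℕ-[]+[] (a <ᵇ x) (b <ᵇ x)) ⟩
    (a <ᵇ x) xor (b <ᵇ x)
      ≡⟨ cong₂ _xor_ (<ᵇ-suc a x) (trans (<ᵇ-suc b x) (cong not (<ᵇ-suc-≢ (t≢b ∘ toℕ-injective)))) ⟩
    not (x <ᵇ suc a) xor not (x <ᵇ b)
      ≡⟨ trans (xor-annihilates-not (x <ᵇ suc a) (x <ᵇ b)) (xor-comm (x <ᵇ suc a) (x <ᵇ b)) ⟩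
    (x <ᵇ b) xor (x <ᵇ suc a)
      ∎
    where
    a = toℕ (first k)
    b = toℕ (second k)
    x = toℕ t

  iP-occurrences : ∀ k y → iP w k y ≡ between w k (first y) xor between w k (second y)
  iP-occurrences k y = trans
    (cong (λ c → isℕ c 1) (count-support₂ (λ t → is (w t) y ∧ between w k t) (first≢second y)
       (λ t t≢a t≢b → cong (_∧ between w k t) (Occ.elsewhere y t t≢a t≢b))))
    (trans (cong₂ (λ p q → isℕ ([ p ∧ between w k (first y) ] + [ q ∧ between w k (second y) ]) 1)
                  (Occ.fst-holds y) (Occ.snd-holds y))
           (isℕ-[]+[] (between w k (first y)) (between w k (second y))))

  ∑-positions : (h : Fin (2 * n) → Bool) → ∑[ t < 2 * n ] h t ≡ ∑[ y < n ] (h (first y) xor h (second y))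
  ∑-positions h = begin
    ∑[ t < 2 * n ] h t
      ≡⟨ sum-cong-≗ (λ t → sym (trans (sum-support₁ ⊕-commutativeMonoid (λ y → is (w t) y ∧ h t) (w t)
                                   (λ y y≢wt → cong (_∧ h t) (is-≢ (y≢wt ∘ sym))))
                                 (cong (_∧ h t) (is-refl (w t))))) ⟩
    ∑[ t < 2 * n ] ∑[ y < n ] (is (w t) y ∧ h t)
      ≡⟨ ∑-comm (λ t y → is (w t) y ∧ h t) ⟩
    ∑[ y < n ] ∑[ t < 2 * n ] (is (w t) y ∧ h t)
      ≡⟨ sum-cong-≗ (λ y → sum-support₂ ⊕-commutativeMonoid (λ t → is (w t) y ∧ h t) (first≢second y)
                             (λ t t≢a t≢b → cong (_∧ h t) (Occ.elsewhere y t t≢a t≢b))) ⟩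
    ∑[ y < n ] ((is (w (first y)) y ∧ h (first y)) xor (is (w (second y)) y ∧ h (second y)))
      ≡⟨ sum-cong-≗ (λ y → cong₂ (λ p q → (p ∧ h (first y)) xor (q ∧ h (second y))) (Occ.fst-holds y) (Occ.snd-holds y)) ⟩
    ∑[ y < n ] (h (first y) xor h (second y))
      ∎

  iP-*ᵥ : ∀ z k → (iP w *ᵥ z) k ≡ ∑[ t < 2 * n ] (between w k t ∧ z (w t))
  iP-*ᵥ z k = begin
    ∑[ y < n ] (iP w k y ∧ z y)
      ≡⟨ sum-cong-≗ (λ y → cong (_∧ z y) (iP-occurrences k y)) ⟩
    ∑[ y < n ] ((between w k (first y) xor between w k (second y)) ∧ z y)
      ≡⟨ sum-cong-≗ (λ y → trans (∧-distribʳ-xor (z y) (between w k (first y)) _)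
                                 (cong₂ (λ p q → (between w k (first y) ∧ z p) xor (between w k (second y) ∧ z q))
                                        (sym (w-first y)) (sym (w-second y)))) ⟩
    ∑[ y < n ] ((between w k (first y) ∧ z (w (first y))) xor (between w k (second y) ∧ z (w (second y))))
      ≡⟨ ∑-positions (λ t → between w k t ∧ z (w t)) ⟨
    ∑[ t < 2 * n ] (between w k t ∧ z (w t))
      ∎

  -- The sum over the positions strictly between the occurrences of k telescopes.
  iP-telescope : ∀ z (q : ℕ → Bool) → (∀ t → z (w t) ≡ q (toℕ t) xor q (suc (toℕ t))) →
                 ∀ k → (iP w *ᵥ z) k ≡ q (suc (toℕ (first k))) xor q (toℕ (second k))
  iP-telescope z q z-steps k = begin
    (iP w *ᵥ z) k
      ≡⟨ iP-*ᵥ z k ⟩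
    ∑[ t < 2 * n ] (between w k t ∧ z (w t))
      ≡⟨ sum-cong-≗ (λ t → cong₂ _∧_ (between-xor k t) (z-steps t)) ⟩
    ∑[ t < 2 * n ] (((toℕ t <ᵇ b) xor (toℕ t <ᵇ suc a)) ∧ step t)
      ≡⟨ sum-cong-≗ (λ t → ∧-distribʳ-xor (step t) (toℕ t <ᵇ b) (toℕ t <ᵇ suc a)) ⟩
    ∑[ t < 2 * n ] (((toℕ t <ᵇ b) ∧ step t) xor ((toℕ t <ᵇ suc a) ∧ step t))
      ≡⟨ ∑-distrib-+ (λ t → (toℕ t <ᵇ b) ∧ step t) (λ t → (toℕ t <ᵇ suc a) ∧ step t) ⟩
    ∑[ t < 2 * n ] ((toℕ t <ᵇ b) ∧ step t) xor ∑[ t < 2 * n ] ((toℕ t <ᵇ suc a) ∧ step t)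
      ≡⟨ cong₂ _xor_ (∑-telescope (2 * n) b q (ℕ.<⇒≤ (toℕ<n (second k))))
                     (∑-telescope (2 * n) (suc a) q (ℕ.<-trans (first<second k) (toℕ<n (second k)))) ⟩
    (q 0 xor q b) xor (q 0 xor q (suc a))
      ≡⟨ cancel (q 0) (q b) (q (suc a)) ⟩
    q (suc a) xor q b
      ∎
    where
    a = toℕ (first k)
    b = toℕ (second k)
    step : Fin (2 * n) → Bool
    step t = q (toℕ t) xor q (suc (toℕ t))
    cancel : ∀ x y z → (x xor y) xor (x xor z) ≡ z xor y
    cancel = solve-∀ 𝔽₂

  inO-parities : ∀ k → inO w k ≡ odd (suc (toℕ (first k))) xor odd (toℕ (second k))
  inO-parities k = trans (⊕sum≡∑ (iP w k))
    (trans (sum-cong-≗ (λ y → sym (∧-identityʳ (iP w k y))))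
           (iP-telescope (λ _ → true) odd (λ t → sym (xor-inverseʳ (odd (toℕ t)))) k))

  iP-irrefl : ∀ k → iP w k k ≡ false
  iP-irrefl k = trans (iP-occurrences k k) (cong₂ _xor_ (between-endpoint (w-first k)) (between-endpoint (w-second k)))

  iP-crossings : ∀ {k y} → k ≢ y →
    iP w k y ≡ crossings (toℕ (first k)) (toℕ (second k)) (toℕ (first y)) (toℕ (second y))
  iP-crossings {k} {y} k≢y = trans (iP-occurrences k y) (cong₂ _xor_
    (trans (between-xor k (first y)) (cong ((toℕ (first y) <ᵇ toℕ (second k)) xor_) (<ᵇ-suc-≢ (distinct (w-first y) (w-first k)))))
    (trans (between-xor k (second y)) (cong ((toℕ (second y) <ᵇ toℕ (second k)) xor_) (<ᵇ-suc-≢ (distinct (w-second y) (w-first k))))))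
    where
    distinct : ∀ {s t} → w s ≡ y → w t ≡ k → toℕ s ≢ toℕ t
    distinct = positions-distinct (k≢y ∘ sym)

  iP-sym : Symmetric (iP w)
  iP-sym k y with k ≟ y
  ... | yes refl = refl
  ... | no k≢y = begin
    iP w k y
      ≡⟨ iP-crossings k≢y ⟩
    crossings (toℕ (first k)) (toℕ (second k)) (toℕ (first y)) (toℕ (second y))
      ≡⟨ crossings-sym (distinct (w-first k) (w-first y)) (distinct (w-first k) (w-second y))
                       (distinct (w-second k) (w-first y)) (distinct (w-second k) (w-second y)) ⟩
    crossings (toℕ (first y)) (toℕ (second y)) (toℕ (first k)) (toℕ (second k))
      ≡⟨ iP-crossings (k≢y ∘ sym) ⟨
    iP w y k
      ∎
    where
    distinct : ∀ {s t} → w s ≡ k → w t ≡ y → toℕ s ≢ toℕ t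
    distinct = positions-distinct k≢y

  module _ (γ : Fin n → Bool) where

    LHS-sym : Symmetric (LHS w γ)
    LHS-sym k y = cong₂ _xor_
      (⊕sum-cong (λ ℓ → trans (cong₂ _∧_ (iP-sym k ℓ) (iP-sym ℓ y)) (∧-comm (iP w ℓ k) (iP w y ℓ))))
      (cong₂ _∧_ (iP-sym k y) (cong not (xor-comm (γ k) (γ y))))

    LHS-diag : ∀ k → LHS w γ k k ≡ inO w k
    LHS-diag k = begin
      ⊕sum (λ ℓ → iP w k ℓ ∧ iP w ℓ k) xor (iP w k k ∧ not (γ k xor γ k))
        ≡⟨ cong₂ _xor_ (⊕sum-cong (λ ℓ → trans (cong (iP w k ℓ ∧_) (iP-sym ℓ k)) (∧-idem (iP w k ℓ))))
                       (cong (_∧ not (γ k xor γ k)) (iP-irrefl k)) ⟩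
      inO w k xor false
        ≡⟨ xor-identityʳ (inO w k) ⟩
      inO w k
        ∎

    LHS-*ᵥ : ∀ z k → (LHS w γ *ᵥ z) k ≡
             (iP w *ᵥ (iP w *ᵥ z)) k xor ((not (γ k) ∧ (iP w *ᵥ z) k) xor (iP w *ᵥ (λ y → γ y ∧ z y)) k)
    LHS-*ᵥ z k = begin
      ∑[ y < n ] (LHS w γ k y ∧ z y)
        ≡⟨ sum-cong-≗ (λ y → trans (cong (λ a → (a xor (iP w k y ∧ not (γ k xor γ y))) ∧ z y) (⊕sum≡∑ (λ ℓ → iP w k ℓ ∧ iP w ℓ y)))
                                   (expand (∑[ ℓ < n ] (iP w k ℓ ∧ iP w ℓ y)) (iP w k y) (γ k) (γ y) (z y))) ⟩
      ∑[ y < n ] ((A² y ∧ z y) xor ((not (γ k) ∧ (iP w k y ∧ z y)) xor (iP w k y ∧ (γ y ∧ z y))))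
        ≡⟨ ∑-distrib-+ (λ y → A² y ∧ z y) _ ⟩
      ∑[ y < n ] (A² y ∧ z y) xor ∑[ y < n ] ((not (γ k) ∧ (iP w k y ∧ z y)) xor (iP w k y ∧ (γ y ∧ z y)))
        ≡⟨ cong₂ _xor_ (*ᵥ-*ᵥ (iP w) (iP w) z k)
             (trans (∑-distrib-+ (λ y → not (γ k) ∧ (iP w k y ∧ z y)) _)
                    (cong (_xor (iP w *ᵥ (λ y → γ y ∧ z y)) k) (sym (∧-distribˡ-∑ (not (γ k)) (λ y → iP w k y ∧ z y))))) ⟩
      (iP w *ᵥ (iP w *ᵥ z)) k xor ((not (γ k) ∧ (iP w *ᵥ z) k) xor (iP w *ᵥ (λ y → γ y ∧ z y)) k)
        ∎
      where
      A² : Fin n → Bool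
      A² y = ∑[ ℓ < n ] (iP w k ℓ ∧ iP w ℓ y)
      expand : ∀ a i g g′ z → (a xor (i ∧ (true xor (g xor g′)))) ∧ z ≡
                              (a ∧ z) xor (((true xor g) ∧ (i ∧ z)) xor (i ∧ (g′ ∧ z)))
      expand = solve-∀ 𝔽₂

    LHS-kills-γ-eigenvectors : ∀ z → (∀ k → (iP w *ᵥ z) k ≡ γ k ∧ z k) → ∀ k → (LHS w γ *ᵥ z) k ≡ false
    LHS-kills-γ-eigenvectors z eigen k = begin
      (LHS w γ *ᵥ z) k
        ≡⟨ LHS-*ᵥ z k ⟩
      (iP w *ᵥ (iP w *ᵥ z)) k xor ((not (γ k) ∧ (iP w *ᵥ z) k) xor X)
        ≡⟨ cong₂ (λ a b → a xor ((not (γ k) ∧ b) xor X)) (*ᵥ-cong (iP w) eigen k) (eigen k) ⟩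
      X xor ((not (γ k) ∧ (γ k ∧ z k)) xor X)
        ≡⟨ cancel (γ k) ⟩
      false
        ∎
      where
      X = (iP w *ᵥ (λ y → γ y ∧ z y)) k
      cancel : ∀ g → X xor ((not g ∧ (g ∧ z k)) xor X) ≡ false
      cancel false = xor-same X
      cancel true  = xor-same X

    LHS-kills-¬γ-eigenvectors : ∀ z → (∀ k → (iP w *ᵥ z) k ≡ not (γ k) ∧ z k) → ∀ k → (LHS w γ *ᵥ z) k ≡ false
    LHS-kills-¬γ-eigenvectors z eigen k = begin
      (LHS w γ *ᵥ z) k
        ≡⟨ LHS-*ᵥ z k ⟩
      (iP w *ᵥ (iP w *ᵥ z)) k xor ((not (γ k) ∧ (iP w *ᵥ z) k) xor X)
        ≡⟨ cong₂ (λ a b → a xor ((not (γ k) ∧ b) xor X)) A²z (eigen k) ⟩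
      ((not (γ k) ∧ z k) xor X) xor ((not (γ k) ∧ (not (γ k) ∧ z k)) xor X)
        ≡⟨ cancel (γ k) ⟩
      false
        ∎
      where
      X = (iP w *ᵥ (λ y → γ y ∧ z y)) k
      not-∧ : ∀ g a → (true xor g) ∧ a ≡ a xor (g ∧ a)
      not-∧ = solve-∀ 𝔽₂
      A²z : (iP w *ᵥ (iP w *ᵥ z)) k ≡ (not (γ k) ∧ z k) xor X
      A²z = trans (*ᵥ-cong (iP w) (λ y → trans (eigen y) (not-∧ (γ y) (z y))) k)
                  (trans (*ᵥ-xor (iP w) z (λ y → γ y ∧ z y) k) (cong (_xor X) (eigen k)))
      cancel : ∀ g → ((not g ∧ z k) xor X) xor ((not g ∧ (not g ∧ z k)) xor X) ≡ false
      cancel false = xor-same (z k xor X)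
      cancel true  = xor-same X

-- Maps and their zigzag

module _ {m} {s s′ : Fin m → Fin m} {k} (orbits : HasOrbits s s′ k) where
  private
    cls = proj₁ orbits

  orbit-class-surjective : ∀ c → ∃ λ f → cls f ≡ c
  orbit-class-surjective = proj₁ (proj₂ orbits)

  orbit-class-invariantˡ : ∀ f → cls (s f) ≡ cls f
  orbit-class-invariantˡ f = sym (Equivalence.from (proj₂ (proj₂ orbits) f (s f)) (inj₁ refl ◅ ε))

  orbit-class-invariantʳ : ∀ f → cls (s′ f) ≡ cls f
  orbit-class-invariantʳ f = sym (Equivalence.from (proj₂ (proj₂ orbits) f (s′ f)) (inj₂ refl ◅ ε))

Invariant : ∀ {m} → (Fin m → Fin m) → (Fin m → Bool) → Set
Invariant s φ = ∀ f → φ (s f) ≡ φ f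

module Realization {n} {w : Fin (2 * n) → Fin n} (gauss : IsGaussCode w) (R : Lacet n w) where
  open Lacet R
  open GaussCode w gauss

  flag : ℕ → Fin m
  flag t = iter ρ t f₀

  τ-σ₂ : ∀ x → τ (σ₂ x) ≡ σ₀ x
  τ-σ₂ x = cong σ₀ (inv₂ x)

  τ-σ₀ : ∀ x → τ (σ₀ x) ≡ σ₂ x
  τ-σ₀ x = trans (cong σ₀ (sym (comm₀₂ x))) (inv₀ (σ₂ x))

  τ-involutive : ∀ x → τ (τ x) ≡ x
  τ-involutive x = trans (τ-σ₀ (σ₂ x)) (inv₂ x)

  ρ-injective : ∀ {x y} → ρ x ≡ ρ y → x ≡ y
  ρ-injective {x} {y} ρx≡ρy = trans (sym (τ-involutive x))
    (trans (cong τ (trans (sym (inv₁ (τ x))) (trans (cong σ₁ ρx≡ρy) (inv₁ (τ y))))) (τ-involutive y))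

  lab-σ₂ : ∀ x → lab (σ₂ x) ≡ lab x
  lab-σ₂ x = Equivalence.from (labEdge x (σ₂ x)) (inj₂ (inj₂ (inj₁ refl)))

  lab-τ : ∀ x → lab (τ x) ≡ lab x
  lab-τ x = Equivalence.from (labEdge x (τ x)) (inj₂ (inj₂ (inj₂ refl)))

  Traversal : Fin m → Fin m → Set
  Traversal x g = g ≡ x ⊎ g ≡ τ x

  Opposite : Fin m → Fin m → Set
  Opposite x g = g ≡ σ₂ x ⊎ g ≡ σ₀ x

  opposite-disjoint : ∀ {x g} → Traversal x g → Opposite x g → ⊥
  opposite-disjoint (inj₁ refl) (inj₁ x≡σ₂x)  = fpf₂ _ (sym x≡σ₂x)
  opposite-disjoint (inj₁ refl) (inj₂ x≡σ₀x)  = fpf₀ _ (sym x≡σ₀x)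
  opposite-disjoint (inj₂ refl) (inj₁ τx≡σ₂x) = fpf₀ _ τx≡σ₂x
  opposite-disjoint {x} (inj₂ refl) (inj₂ τx≡σ₀x) =
    fpf₂ x (trans (sym (inv₀ (σ₂ x))) (trans (cong σ₀ τx≡σ₀x) (inv₀ x)))

  σ₂-opposite : ∀ {x g} → Traversal x g → Opposite x (σ₂ g)
  σ₂-opposite (inj₁ refl) = inj₁ refl
  σ₂-opposite {x} (inj₂ refl) = inj₂ (trans (sym (comm₀₂ (σ₂ x))) (cong σ₀ (inv₂ x)))

  τ-traversal : ∀ {x g} → Traversal x g → Traversal x (τ g)
  τ-traversal (inj₁ refl) = inj₂ refl
  τ-traversal (inj₂ refl) = inj₁ (τ-involutive _)

  entry₁ entry₂ : Fin n → Fin m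
  entry₁ k = entry (first k)
  entry₂ k = entry (second k)

  lab-entry₁ : ∀ k → lab (entry₁ k) ≡ k
  lab-entry₁ k = trans (reads (first k)) (w-first k)

  lab-traversal : ∀ {g} j → Traversal (entry j) g → lab g ≡ w j
  lab-traversal j (inj₁ refl) = reads j
  lab-traversal j (inj₂ refl) = trans (lab-τ (entry j)) (reads j)

  entry₂-cases : ∀ k → entry₂ k ≡ σ₂ (entry₁ k) ⊎ entry₂ k ≡ σ₀ (entry₁ k)
  entry₂-cases k with single (σ₂ (entry₁ k))
  ... | j , on-j with occurrence (trans (sym (lab-traversal j on-j)) (trans (lab-σ₂ (entry₁ k)) (lab-entry₁ k)))
  ... | inj₁ refl = ⊥-elim (opposite-disjoint on-j (σ₂-opposite (inj₁ refl)))
  ... | inj₂ refl = case on-j of λ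
          { (inj₁ σ₂x≡y)  → inj₁ (sym σ₂x≡y)
          ; (inj₂ σ₂x≡τy) → inj₂ (trans (sym (τ-involutive (entry₂ k))) (trans (cong τ (sym σ₂x≡τy)) (τ-σ₂ (entry₁ k)))) }

  entry₂-opposite : ∀ {k g} → Traversal (entry₂ k) g → Opposite (entry₁ k) g
  entry₂-opposite {k} on-e₂ with entry₂-cases k | on-e₂
  ... | inj₁ e₂≡σ₂e₁ | inj₁ g≡e₂  = inj₁ (trans g≡e₂ e₂≡σ₂e₁)
  ... | inj₁ e₂≡σ₂e₁ | inj₂ g≡τe₂ = inj₂ (trans g≡τe₂ (trans (cong τ e₂≡σ₂e₁) (τ-σ₂ (entry₁ k))))
  ... | inj₂ e₂≡σ₀e₁ | inj₁ g≡e₂  = inj₂ (trans g≡e₂ e₂≡σ₀e₁)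
  ... | inj₂ e₂≡σ₀e₁ | inj₂ g≡τe₂ = inj₁ (trans g≡τe₂ (trans (cong τ e₂≡σ₀e₁) (τ-σ₀ (entry₁ k))))

  black⇒entry₂ : ∀ {k} → Black k → entry₂ k ≡ σ₂ (entry₁ k)
  black⇒entry₂ (j , j′ , j≢j′ , wj , wj′ , entry-j′) with occurrence wj | occurrence wj′
  ... | inj₁ refl | inj₁ refl = ⊥-elim (j≢j′ refl)
  ... | inj₂ refl | inj₂ refl = ⊥-elim (j≢j′ refl)
  ... | inj₁ refl | inj₂ refl = entry-j′
  ... | inj₂ refl | inj₁ refl = trans (sym (inv₂ (entry j))) (cong σ₂ (sym entry-j′))

  traversal-cong : ∀ {g i i′} → i ≡ i′ → Traversal (entry i) g → Traversal (entry i′) g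
  traversal-cong {g} = subst (λ i → Traversal (entry i) g)

  traversals-disjoint : ∀ {g} (j j′ : Fin (2 * n)) → j ≢ j′ → Traversal (entry j) g → Traversal (entry j′) g → ⊥
  traversals-disjoint {g} j j′ j≢j′ on-j on-j′
    with occurrence {w j} refl | occurrence (trans (sym (lab-traversal j′ on-j′)) (lab-traversal j on-j))
  ... | inj₁ j≡a | inj₁ j′≡a = j≢j′ (trans j≡a (sym j′≡a))
  ... | inj₂ j≡b | inj₂ j′≡b = j≢j′ (trans j≡b (sym j′≡b))
  ... | inj₁ j≡a | inj₂ j′≡b =
    opposite-disjoint (traversal-cong j≡a on-j) (entry₂-opposite (traversal-cong j′≡b on-j′))
  ... | inj₂ j≡b | inj₁ j′≡a =
    opposite-disjoint (traversal-cong j′≡a on-j′) (entry₂-opposite (traversal-cong j≡b on-j))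

  traversal-unique : ∀ {g s t} → s < 2 * n → t < 2 * n → Traversal (flag s) g → Traversal (flag t) g → s ≡ t
  traversal-unique {g} {s} {t} s<N t<N on-s on-t with fromℕ< s<N ≟ fromℕ< t<N
  ... | yes eq = trans (sym (toℕ-fromℕ< s<N)) (trans (cong toℕ eq) (toℕ-fromℕ< t<N))
  ... | no neq = ⊥-elim (traversals-disjoint _ _ neq (on (toℕ-fromℕ< s<N) on-s) (on (toℕ-fromℕ< t<N) on-t))
    where
    on : ∀ {u v} → v ≡ u → Traversal (flag u) g → Traversal (flag v) g
    on v≡u = subst (λ u → Traversal (flag u) g) (sym v≡u)

  position : Fin m → ℕ
  position g = toℕ (proj₁ (single g))

  position<N : ∀ g → position g < 2 * n
  position<N g = toℕ<n (proj₁ (single g))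

  on-position : ∀ g → Traversal (flag (position g)) g
  on-position g = proj₂ (single g)

  position-of : ∀ {g t} → t < 2 * n → Traversal (flag t) g → position g ≡ t
  position-of {g} t<N on-t = traversal-unique (position<N g) t<N (on-position g) on-t

  last<N : ∀ {t} → suc t ≡ 2 * n → t < 2 * n
  last<N {t} 1+t≡N = subst (t <_) 1+t≡N (ℕ.n<1+n t)

  -- ρ is injective and the 2n traversals are disjoint, so ρ can only take the last traversal back to f₀.
  closes : ∀ {t} → suc t ≡ 2 * n → flag (suc t) ≡ f₀
  closes {t} 1+t≡N with on-position (flag (suc t)) | position<N (flag (suc t))
  ... | inj₁ at-p | p<N with position (flag (suc t))
  ...   | zero   = at-p
  ...   | suc p′ = ⊥-elim (ℕ.<-irrefl (trans (cong suc (sym t≡p′)) 1+t≡N) p<N)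
    where
    t≡p′ : t ≡ p′
    t≡p′ = traversal-unique (last<N 1+t≡N) (ℕ.<-trans (ℕ.n<1+n p′) p<N) (inj₁ refl) (inj₁ (ρ-injective at-p))
  closes {t} 1+t≡N | inj₂ at-τp | p<N with ℕ.m≤n⇒m<n∨m≡n (subst (suc (position (flag (suc t))) ≤_) (sym 1+t≡N) p<N)
  ... | inj₁ 1+p<1+t = ⊥-elim (fpf₀₂ (flag t) (subst (λ u → τ (flag t) ≡ flag u) (sym t≡1+p) τflag-t≡flag-1+p))
    where
    p = position (flag (suc t))
    τflag-t≡flag-1+p : τ (flag t) ≡ flag (suc p)
    τflag-t≡flag-1+p = trans (sym (inv₁ (τ (flag t)))) (cong σ₁ at-τp)
    t≡1+p : t ≡ suc p
    t≡1+p = traversal-unique (last<N 1+t≡N) (subst (suc p <_) 1+t≡N 1+p<1+t) (inj₂ refl) (inj₁ τflag-t≡flag-1+p)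
  ... | inj₂ 1+p≡1+t = ⊥-elim (fpf₁ (τ (flag t)) (trans at-τp (cong (τ ∘ flag) (ℕ.suc-injective 1+p≡1+t))))

  odd-last : ∀ {t} → suc t ≡ 2 * n → odd t ≡ true
  odd-last {t} 1+t≡N = trans (sym (not-involutive (odd t))) (cong not (trans (cong odd 1+t≡N) odd-2n))
    where
    odd-2n : odd (2 * n) ≡ false
    odd-2n = trans (odd-+ n (n + 0)) (trans (cong (odd n xor_) (trans (odd-+ n 0) (xor-identityʳ (odd n)))) (xor-same (odd n)))

  colour : Fin m → Bool
  colour g = odd (position g)

  colour-σ₁-entry : ∀ {g} t → t < 2 * n → g ≡ flag t → colour (σ₁ g) ≡ not (odd t)
  colour-σ₁-entry {g} zero 0<N refl with last-index 0<N
  ... | N′ , 1+N′≡N = trans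
    (cong odd (position-of (last<N 1+N′≡N)
                           (inj₂ (trans (cong σ₁ (sym (closes 1+N′≡N))) (inv₁ (τ (flag N′)))))))
    (odd-last 1+N′≡N)
  colour-σ₁-entry {g} (suc t) t<N refl = trans
    (cong odd (position-of (ℕ.<-trans (ℕ.n<1+n t) t<N) (inj₂ (inv₁ (τ (flag t))))))
    (sym (not-involutive (odd t)))

  colour-σ₁-exit : ∀ {g} t → t < 2 * n → g ≡ τ (flag t) → colour (σ₁ g) ≡ not (odd t)
  colour-σ₁-exit {g} t t<N refl with ℕ.m≤n⇒m<n∨m≡n t<N
  ... | inj₁ 1+t<N = cong odd (position-of 1+t<N (inj₁ refl))
  ... | inj₂ 1+t≡N = trans (cong odd (position-of (ℕ.<-≤-trans (s≤s z≤n) t<N) (inj₁ (closes 1+t≡N))))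
                           (sym (cong not (odd-last 1+t≡N)))

  colour-σ₁ : ∀ g → colour (σ₁ g) ≡ not (colour g)
  colour-σ₁ g with on-position g
  ... | inj₁ g≡entry = colour-σ₁-entry (position g) (position<N g) g≡entry
  ... | inj₂ g≡exit  = colour-σ₁-exit (position g) (position<N g) g≡exit

  colour-τ : ∀ g → colour (τ g) ≡ colour g
  colour-τ g = cong odd (position-of (position<N g) (τ-traversal (on-position g)))

  colour-σ₂ : (∀ k → inO w k ≡ false) → ∀ g → colour (σ₂ g) ≡ not (colour g)
  colour-σ₂ 𝒪≡∅ g = other-occurrence (occurrence {w j} refl) (occurrence w-j′)
    where
    j  = proj₁ (single g)
    j′ = proj₁ (single (σ₂ g))
    k  = w j
    w-j′ : w j′ ≡ k
    w-j′ = trans (sym (lab-traversal j′ (on-position (σ₂ g)))) (trans (lab-σ₂ g) (lab-traversal j (on-position g)))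
    j≢j′ : j ≢ j′
    j≢j′ j≡j′ = opposite-disjoint (traversal-cong (sym j≡j′) (on-position (σ₂ g))) (σ₂-opposite (on-position g))
    parity : odd (toℕ (second k)) ≡ not (odd (toℕ (first k)))
    parity = sym (xor≡false⇒≡ (trans (sym (inO-parities k)) (𝒪≡∅ k)))
    other-occurrence : j ≡ first k ⊎ j ≡ second k → j′ ≡ first k ⊎ j′ ≡ second k → odd (toℕ j′) ≡ not (odd (toℕ j))
    other-occurrence (inj₁ j≡a) (inj₁ j′≡a) = ⊥-elim (j≢j′ (trans j≡a (sym j′≡a)))
    other-occurrence (inj₂ j≡b) (inj₂ j′≡b) = ⊥-elim (j≢j′ (trans j≡b (sym j′≡b)))
    other-occurrence (inj₁ j≡a) (inj₂ j′≡b) =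
      trans (cong (odd ∘ toℕ) j′≡b) (trans parity (cong (not ∘ odd ∘ toℕ) (sym j≡a)))
    other-occurrence (inj₂ j≡b) (inj₁ j′≡a) =
      trans (cong (odd ∘ toℕ) j′≡a)
            (trans (sym (not-involutive _)) (cong not (trans (sym parity) (cong (odd ∘ toℕ) (sym j≡b)))))

  orientable-if-𝒪-empty : (∀ k → inO w k ≡ false) → Orientable
  orientable-if-𝒪-empty 𝒪≡∅ = colour , λ g →
      trans (cong colour (sym (τ-σ₂ g))) (trans (colour-τ (σ₂ g)) (colour-σ₂ 𝒪≡∅ g))
    , colour-σ₁ g
    , colour-σ₂ 𝒪≡∅ g

  ∂ : (Fin m → Bool) → Fin n → Bool
  ∂ φ k = φ (entry₁ k) xor φ (τ (entry₁ k))

  σ₀-like-τ : ∀ {φ} → Invariant σ₂ φ → ∀ x → φ (σ₀ x) ≡ φ (τ x)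
  σ₀-like-τ {φ} σ₂-inv x = trans (sym (σ₂-inv (σ₀ x))) (cong φ (sym (comm₀₂ x)))

  σ₂-like-τ : ∀ {φ} → Invariant σ₀ φ → ∀ x → φ (σ₂ x) ≡ φ (τ x)
  σ₂-like-τ σ₀-inv x = sym (σ₀-inv (σ₂ x))

  -- Invariance under σ₂ or σ₀ makes φ g + φ (τ g) the same at the four flags of an edge.
  ∂-at : ∀ {φ} → Invariant σ₂ φ ⊎ Invariant σ₀ φ → ∀ g → ∂ φ (lab g) ≡ φ g xor φ (τ g)
  ∂-at {φ} inv g = edge-flags (Equivalence.to (labEdge x g) (sym (lab-entry₁ (lab g))))
    where
    x = entry₁ (lab g)
    across′ : Invariant σ₂ φ ⊎ Invariant σ₀ φ → φ x xor φ (τ x) ≡ φ (σ₀ x) xor φ (σ₂ x)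
    across′ (inj₁ σ₂-inv) = trans (xor-comm (φ x) (φ (τ x))) (sym (cong₂ _xor_ (σ₀-like-τ σ₂-inv x) (σ₂-inv x)))
    across′ (inj₂ σ₀-inv) = sym (cong₂ _xor_ (σ₀-inv x) (σ₂-like-τ σ₀-inv x))
    across = across′ inv
    pair : Fin m → Bool
    pair h = φ h xor φ (τ h)
    edge-flags : g ≡ x ⊎ g ≡ σ₀ x ⊎ g ≡ σ₂ x ⊎ g ≡ τ x → pair x ≡ pair g
    edge-flags (inj₁ g≡x)               = cong pair (sym g≡x)
    edge-flags (inj₂ (inj₁ g≡σ₀x))        = begin
      pair x                 ≡⟨ across ⟩
      φ (σ₀ x) xor φ (σ₂ x)  ≡⟨ cong (λ h → φ (σ₀ x) xor φ h) (τ-σ₀ x) ⟨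
      pair (σ₀ x)            ≡⟨ cong pair g≡σ₀x ⟨
      pair g                 ∎
    edge-flags (inj₂ (inj₂ (inj₁ g≡σ₂x))) = begin
      pair x                 ≡⟨ across ⟩
      φ (σ₀ x) xor φ (σ₂ x)  ≡⟨ xor-comm (φ (σ₀ x)) (φ (σ₂ x)) ⟩
      φ (σ₂ x) xor φ (σ₀ x)  ≡⟨ cong (λ h → φ (σ₂ x) xor φ h) (τ-σ₂ x) ⟨
      pair (σ₂ x)            ≡⟨ cong pair g≡σ₂x ⟨
      pair g                 ∎
    edge-flags (inj₂ (inj₂ (inj₂ g≡τx))) = begin
      pair x           ≡⟨ xor-comm (φ x) (φ (τ x)) ⟩
      φ (τ x) xor φ x  ≡⟨ cong (λ h → φ (τ x) xor φ h) (τ-involutive x) ⟨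
      pair (τ x)       ≡⟨ cong pair g≡τx ⟨
      pair g           ∎

  iP-∂ : ∀ {φ} → Invariant σ₁ φ → Invariant σ₂ φ ⊎ Invariant σ₀ φ →
         ∀ k → (iP w *ᵥ ∂ φ) k ≡ φ (τ (entry₁ k)) xor φ (entry₂ k)
  iP-∂ {φ} σ₁-inv inv k = trans (iP-telescope (∂ φ) (φ ∘ flag) step k) (cong (_xor φ (entry₂ k)) (σ₁-inv (τ (entry₁ k))))
    where
    step : ∀ t → ∂ φ (w t) ≡ φ (flag (toℕ t)) xor φ (flag (suc (toℕ t)))
    step t = trans (cong (∂ φ) (sym (reads t)))
                   (trans (∂-at inv (entry t)) (cong (φ (entry t) xor_) (sym (σ₁-inv (τ (entry t))))))

  ∂≡0⇒τ-invariant : ∀ {φ} → Invariant σ₂ φ ⊎ Invariant σ₀ φ → (∀ k → ∂ φ k ≡ false) → Invariant τ φ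
  ∂≡0⇒τ-invariant {φ} inv ∂φ≡0 g = sym (xor≡false⇒≡ (trans (sym (∂-at inv g)) (∂φ≡0 (lab g))))

  constant-if-invariant : ∀ {φ} → Invariant σ₀ φ → Invariant σ₁ φ → Invariant σ₂ φ → ∀ f → φ f ≡ φ f₀
  constant-if-invariant {φ} σ₀-inv σ₁-inv σ₂-inv f = walk (connected f₀ f)
    where
    walk : ∀ {a b} → Star (λ a b → b ≡ σ₀ a ⊎ b ≡ σ₁ a ⊎ b ≡ σ₂ a) a b → φ b ≡ φ a
    walk ε                        = refl
    walk (inj₁ refl ◅ path)        = trans (walk path) (σ₀-inv _)
    walk (inj₂ (inj₁ refl) ◅ path) = trans (walk path) (σ₁-inv _)
    walk (inj₂ (inj₂ refl) ◅ path) = trans (walk path) (σ₂-inv _)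

  lincomb-∂ : ∀ {K} d (φ : Fin K → Fin m → Bool) k → lincomb d (λ i → ∂ (φ i)) k ≡ ∂ (lincomb d φ) k
  lincomb-∂ d φ k = trans (sum-cong-≗ (λ i → ∧-distribˡ-xor (d i) (φ i (entry₁ k)) (φ i (τ (entry₁ k)))))
                          (∑-distrib-+ (λ i → d i ∧ φ i (entry₁ k)) (λ i → d i ∧ φ i (τ (entry₁ k))))

  -- Class 0 is left out, which removes the constant functions: those are what ∂ kills.
  indicators : ∀ {K} → (Fin K → Bool) → Fin (suc K) → Bool
  indicators {K} d c = ∑[ i < K ] (d i ∧ is c (suc i))

  constant-indicators⇒zero : ∀ {K} (cls : Fin m → Fin (suc K)) → (∀ c → ∃ λ f → cls f ≡ c) →
                             ∀ d → (∀ f → indicators d (cls f) ≡ indicators d (cls f₀)) → ∀ i → d i ≡ false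
  constant-indicators⇒zero {K} cls cls-onto d constant i = begin
    d i                     ≡⟨ at-suc ⟨
    indicators d (suc i)    ≡⟨ cong (indicators d) (proj₂ (cls-onto (suc i))) ⟨
    indicators d (cls fᵢ)   ≡⟨ constant fᵢ ⟩
    indicators d (cls f₀)   ≡⟨ constant f₀′ ⟨
    indicators d (cls f₀′)  ≡⟨ cong (indicators d) (proj₂ (cls-onto zero)) ⟩
    indicators d zero       ≡⟨ ∑-zero {K} _ (λ j → ∧-zeroʳ (d j)) ⟩
    false                   ∎
    where
    fᵢ  = proj₁ (cls-onto (suc i))
    f₀′ = proj₁ (cls-onto zero)
    at-suc : indicators d (suc i) ≡ d i
    at-suc = trans (sum-support₁ ⊕-commutativeMonoid (λ j → d j ∧ is (suc i) (suc j)) i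
                     (λ j j≢i → trans (cong (d j ∧_) (is-≢ (j≢i ∘ sym ∘ suc-injective))) (∧-zeroʳ (d j))))
                   (trans (cong (d i ∧_) (is-refl (suc i))) (∧-identityʳ (d i)))

  module Colouring (γ : Fin n → Bool) (γ-black : ∀ k → (γ k ≡ true) ⇔ Black k) where

    data Entry₂ (k : Fin n) : Set where
      black : γ k ≡ true  → entry₂ k ≡ σ₂ (entry₁ k) → Entry₂ k
      white : γ k ≡ false → entry₂ k ≡ σ₀ (entry₁ k) → Entry₂ k

    entry₂-colour : ∀ k → Entry₂ k
    entry₂-colour k with γ k in γk
    ... | true  = black γk (black⇒entry₂ (Equivalence.to (γ-black k) γk))
    ... | false with entry₂-cases k
    ...   | inj₂ e₂≡σ₀e₁ = white γk e₂≡σ₀e₁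
    ...   | inj₁ e₂≡σ₂e₁ with () ← trans (sym γk)
              (Equivalence.from (γ-black k) (first k , second k , first≢second k , w-first k , w-second k , e₂≡σ₂e₁))

    iP-∂-vertex : ∀ {φ} → Invariant σ₁ φ → Invariant σ₂ φ → ∀ k → (iP w *ᵥ ∂ φ) k ≡ γ k ∧ ∂ φ k
    iP-∂-vertex {φ} σ₁-inv σ₂-inv k = trans (iP-∂ σ₁-inv (inj₁ σ₂-inv) k) (by-colour (entry₂-colour k))
      where
      x = entry₁ k
      by-colour : Entry₂ k → φ (τ x) xor φ (entry₂ k) ≡ γ k ∧ ∂ φ k
      by-colour (black γk e₂≡σ₂x) = begin
        φ (τ x) xor φ (entry₂ k)  ≡⟨ cong (φ (τ x) xor_) (trans (cong φ e₂≡σ₂x) (σ₂-inv x)) ⟩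
        φ (τ x) xor φ x           ≡⟨ xor-comm (φ (τ x)) (φ x) ⟩
        ∂ φ k                     ≡⟨ cong (_∧ ∂ φ k) γk ⟨
        γ k ∧ ∂ φ k               ∎
      by-colour (white γk e₂≡σ₀x) = begin
        φ (τ x) xor φ (entry₂ k)  ≡⟨ cong (φ (τ x) xor_) (trans (cong φ e₂≡σ₀x) (σ₀-like-τ σ₂-inv x)) ⟩
        φ (τ x) xor φ (τ x)       ≡⟨ xor-same (φ (τ x)) ⟩
        false                     ≡⟨ cong (_∧ ∂ φ k) γk ⟨
        γ k ∧ ∂ φ k               ∎

    iP-∂-face : ∀ {φ} → Invariant σ₀ φ → Invariant σ₁ φ → ∀ k → (iP w *ᵥ ∂ φ) k ≡ not (γ k) ∧ ∂ φ k
    iP-∂-face {φ} σ₀-inv σ₁-inv k = trans (iP-∂ σ₁-inv (inj₂ σ₀-inv) k) (by-colour (entry₂-colour k))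
      where
      x = entry₁ k
      by-colour : Entry₂ k → φ (τ x) xor φ (entry₂ k) ≡ not (γ k) ∧ ∂ φ k
      by-colour (black γk e₂≡σ₂x) = begin
        φ (τ x) xor φ (entry₂ k)  ≡⟨ cong (φ (τ x) xor_) (trans (cong φ e₂≡σ₂x) (σ₂-like-τ σ₀-inv x)) ⟩
        φ (τ x) xor φ (τ x)       ≡⟨ xor-same (φ (τ x)) ⟩
        false                     ≡⟨ cong (λ g → not g ∧ ∂ φ k) γk ⟨
        not (γ k) ∧ ∂ φ k         ∎
      by-colour (white γk e₂≡σ₀x) = begin
        φ (τ x) xor φ (entry₂ k)  ≡⟨ cong (φ (τ x) xor_) (trans (cong φ e₂≡σ₀x) (σ₀-inv x)) ⟩
        φ (τ x) xor φ x           ≡⟨ xor-comm (φ (τ x)) (φ x) ⟩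
        ∂ φ k                     ≡⟨ cong (λ g → not g ∧ ∂ φ k) γk ⟨
        not (γ k) ∧ ∂ φ k         ∎

    module Coboundaries (V F : ℕ) (vertices : HasOrbits σ₁ σ₂ (suc V)) (faces : HasOrbits σ₀ σ₁ (suc F)) where

      vertex : Fin m → Fin (suc V)
      vertex = proj₁ vertices

      face : Fin m → Fin (suc F)
      face = proj₁ faces

      vertex-coboundary : Fin V → Fin n → Bool
      vertex-coboundary i = ∂ (λ f → is (vertex f) (suc i))

      face-coboundary : Fin F → Fin n → Bool
      face-coboundary j = ∂ (λ f → is (face f) (suc j))

      coboundaries : Fin (V + F) → Fin n → Bool
      coboundaries = vertex-coboundary ++ face-coboundary

      module _ (T : Fin (suc V) → Bool) where
        vertex-σ₁ : Invariant σ₁ (T ∘ vertex)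
        vertex-σ₁ f = cong T (orbit-class-invariantˡ vertices f)

        vertex-σ₂ : Invariant σ₂ (T ∘ vertex)
        vertex-σ₂ f = cong T (orbit-class-invariantʳ vertices f)

      module _ (T : Fin (suc F) → Bool) where
        face-σ₀ : Invariant σ₀ (T ∘ face)
        face-σ₀ f = cong T (orbit-class-invariantˡ faces f)

        face-σ₁ : Invariant σ₁ (T ∘ face)
        face-σ₁ f = cong T (orbit-class-invariantʳ faces f)

      vertex-coboundaries-independent : ∀ d → (∀ k → ∂ (indicators d ∘ vertex) k ≡ false) → ∀ i → d i ≡ false
      vertex-coboundaries-independent d ∂≡0 = constant-indicators⇒zero vertex (orbit-class-surjective vertices) d
        (constant-if-invariant σ₀-inv (vertex-σ₁ (indicators d)) (vertex-σ₂ (indicators d)))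
        where
        σ₀-inv : Invariant σ₀ (indicators d ∘ vertex)
        σ₀-inv g = trans (cong (indicators d ∘ vertex) (sym (τ-σ₂ g)))
                         (trans (∂≡0⇒τ-invariant (inj₁ (vertex-σ₂ (indicators d))) ∂≡0 (σ₂ g)) (vertex-σ₂ (indicators d) g))

      face-coboundaries-independent : ∀ d → (∀ k → ∂ (indicators d ∘ face) k ≡ false) → ∀ i → d i ≡ false
      face-coboundaries-independent d ∂≡0 = constant-indicators⇒zero face (orbit-class-surjective faces) d
        (constant-if-invariant (face-σ₀ (indicators d)) (face-σ₁ (indicators d)) σ₂-inv)
        where
        σ₂-inv : Invariant σ₂ (indicators d ∘ face)
        σ₂-inv g = trans (cong (indicators d ∘ face) (sym (τ-σ₀ g)))
                         (trans (∂≡0⇒τ-invariant (inj₂ (face-σ₀ (indicators d))) ∂≡0 (σ₀ g)) (face-σ₀ (indicators d) g))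

      coboundaries-in-kernel : ∀ i k → (LHS w γ *ᵥ coboundaries i) k ≡ false
      coboundaries-in-kernel i k with splitAt V i
      ... | inj₁ j = LHS-kills-γ-eigenvectors γ (vertex-coboundary j)
                       (iP-∂-vertex (vertex-σ₁ (λ c → is c (suc j))) (vertex-σ₂ (λ c → is c (suc j)))) k
      ... | inj₂ j = LHS-kills-¬γ-eigenvectors γ (face-coboundary j)
                       (iP-∂-face (face-σ₀ (λ c → is c (suc j))) (face-σ₁ (λ c → is c (suc j)))) k

      -- A common vector of the two spans is an eigenvector of i_P for both γ and not γ, hence zero.
      coboundaries-independent : Independent coboundaries
      coboundaries-independent (d , d≢0 , d·∂≡0) = both-parts-zero (nonzero-↑ {V} d≢0)
        where
        d₁ : Fin V → Bool
        d₁ = d ∘ (_↑ˡ F)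
        d₂ : Fin F → Bool
        d₂ = d ∘ (V ↑ʳ_)
        Φ₁ Φ₂ : Fin m → Bool
        Φ₁ = indicators d₁ ∘ vertex
        Φ₂ = indicators d₂ ∘ face
        ∂Φ₁≡∂Φ₂ : ∀ k → ∂ Φ₁ k ≡ ∂ Φ₂ k
        ∂Φ₁≡∂Φ₂ k = xor≡false⇒≡ (begin
          ∂ Φ₁ k xor ∂ Φ₂ k
            ≡⟨ cong₂ _xor_ (lincomb-∂ d₁ (λ i f → is (vertex f) (suc i)) k) (lincomb-∂ d₂ (λ j f → is (face f) (suc j)) k) ⟨
          lincomb d₁ vertex-coboundary k xor lincomb d₂ face-coboundary k
            ≡⟨ lincomb-++ d vertex-coboundary face-coboundary k ⟨
          lincomb d coboundaries k
            ≡⟨ d·∂≡0 k ⟩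
          false
            ∎)
        ∂Φ₁≡0 : ∀ k → ∂ Φ₁ k ≡ false
        ∂Φ₁≡0 k = ∧-not-cancel (γ k) (begin
          γ k ∧ ∂ Φ₁ k           ≡⟨ iP-∂-vertex (vertex-σ₁ (indicators d₁)) (vertex-σ₂ (indicators d₁)) k ⟨
          (iP w *ᵥ ∂ Φ₁) k       ≡⟨ *ᵥ-cong (iP w) ∂Φ₁≡∂Φ₂ k ⟩
          (iP w *ᵥ ∂ Φ₂) k       ≡⟨ iP-∂-face (face-σ₀ (indicators d₂)) (face-σ₁ (indicators d₂)) k ⟩
          not (γ k) ∧ ∂ Φ₂ k     ≡⟨ cong (not (γ k) ∧_) (∂Φ₁≡∂Φ₂ k) ⟨
          not (γ k) ∧ ∂ Φ₁ k     ∎)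
        ∂Φ₂≡0 : ∀ k → ∂ Φ₂ k ≡ false
        ∂Φ₂≡0 k = trans (sym (∂Φ₁≡∂Φ₂ k)) (∂Φ₁≡0 k)
        both-parts-zero : Nonzero d₁ ⊎ Nonzero d₂ → ⊥
        both-parts-zero (inj₁ (i , d₁i)) = case trans (sym d₁i) (vertex-coboundaries-independent d₁ ∂Φ₁≡0 i) of λ ()
        both-parts-zero (inj₂ (i , d₂i)) = case trans (sym d₂i) (face-coboundaries-independent d₂ ∂Φ₂≡0 i) of λ ()

-- Solving the system

rank-two-form≡RHS : ∀ uk hk uy hy → (uk ∧ uy) xor (hk ∧ hy) ≡
  (if uk xor hk then (if uy xor hy then true xor hk xor hy else hy) else (hk ∧ (uy xor hy)))
rank-two-form≡RHS true  true  uy    hy    = refl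
rank-two-form≡RHS false false uy    hy    = refl
rank-two-form≡RHS true  false true  true  = refl
rank-two-form≡RHS true  false true  false = refl
rank-two-form≡RHS true  false false true  = refl
rank-two-form≡RHS true  false false false = refl
rank-two-form≡RHS false true  true  true  = refl
rank-two-form≡RHS false true  true  false = refl
rank-two-form≡RHS false true  false true  = refl
rank-two-form≡RHS false true  false false = refl

suc+suc : ∀ V F → suc V + suc F ≡ (V + F) + 2
suc+suc = solve-∀ℕ

sphere-bound : ∀ {V F n} → suc V + suc F ≡ n + 2 → n < (V + F) + 1
sphere-bound {V} {F} {n} e = subst (_< (V + F) + 1) (sym n≡V+F) (ℕ.m<m+n (V + F) (s≤s z≤n))
  where
  n≡V+F : n ≡ V + F
  n≡V+F = ℕ.+-cancelʳ-≡ 2 n (V + F) (trans (sym e) (suc+suc V F))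

nonorientable-bound : ∀ {V F n} → n ≤ suc V + suc F → n < (V + F) + 3
nonorientable-bound {V} {F} {n} n≤ =
  ℕ.≤-<-trans (subst (n ≤_) (suc+suc V F) n≤) (ℕ.+-monoʳ-< (V + F) (ℕ.n<1+n 2))

module Solutions {n} {w : Fin (2 * n) → Fin n} (gauss : IsGaussCode w) (R : Lacet n w)
                 (γ : Fin n → Bool) (γ-black : ∀ k → (γ k ≡ true) ⇔ Lacet.Black R k) where
  open Lacet R
  open GaussCode w gauss
  open Realization gauss R
  open Colouring γ γ-black

  Solution : Set
  Solution = ∃ λ (δ : Fin n → Bool) → ∀ k y → LHS w γ k y ≡ RHS w δ k y

  module _ {V F} (vertices : HasOrbits σ₁ σ₂ (suc V)) (faces : HasOrbits σ₀ σ₁ (suc F)) where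
    open Coboundaries V F vertices faces

    columns-dependent : ∀ {K} → n < (V + F) + K → (x : Fin K → Fin n) → Dependent (λ i → col (LHS w γ) (x i))
    columns-dependent n<V+F+K x = dependent-cong (λ i → *ᵥ-unit (LHS w γ) (x i))
      (image-dependent (LHS w γ) coboundaries coboundaries-independent coboundaries-in-kernel n<V+F+K (λ i j → is j (x i)))

    sphere-solution : n < (V + F) + 1 → Solution
    sphere-solution n<V+F+1 = (λ _ → false) , λ k y → trans (LHS≡0 k y) (sym (RHS≡0 k y))
      where
      LHS≡0 : ∀ k y → LHS w γ k y ≡ false
      LHS≡0 k y = dependent-single (columns-dependent n<V+F+1 (λ _ → y)) k
      RHS≡0 : ∀ k y → RHS w (λ _ → false) k y ≡ false
      RHS≡0 k y = cong (λ b → if b then (if inO w y then true xor false xor false else false) else (false ∧ inO w y))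
                       (trans (sym (LHS-diag γ k)) (LHS≡0 k k))

    nonorientable-solution : n < (V + F) + 3 → ¬ Orientable → Solution
    nonorientable-solution n<V+F+3 non-orientable with nonzero? (inO w)
    ... | inj₂ 𝒪≡∅ = ⊥-elim (non-orientable (orientable-if-𝒪-empty 𝒪≡∅))
    ... | inj₁ (k₀ , k₀∈𝒪) =
      let u , h , G≡uuᵀ+hhᵀ = symmetric-rank≤2 (LHS w γ) (LHS-sym γ) k₀ (trans (LHS-diag γ k₀) k₀∈𝒪)
                                (λ y y′ → columns-dependent n<V+F+3 (k₀ ∷ y ∷ y′ ∷ []))
          inO≡u+h : ∀ k → inO w k ≡ u k xor h k
          inO≡u+h k = trans (sym (LHS-diag γ k)) (trans (G≡uuᵀ+hhᵀ k k) (cong₂ _xor_ (∧-idem (u k)) (∧-idem (h k))))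
      in h , λ k y → trans (G≡uuᵀ+hhᵀ k y)
                    (trans (rank-two-form≡RHS (u k) (h k) (u y) (h y))
                           (sym (cong₂ (λ a b → if a then (if b then true xor h k xor h y else h y) else (h k ∧ b))
                                       (inO≡u+h k) (inO≡u+h y))))

  sphere-case : ∀ v fc → HasOrbits σ₁ σ₂ v → HasOrbits σ₀ σ₁ fc → v + fc ≡ n + 2 → Solution
  sphere-case zero    _       vertices _     _ = ⊥-elim (case proj₁ vertices f₀ of λ ())
  sphere-case (suc V) zero    _        faces _ = ⊥-elim (case proj₁ faces f₀ of λ ())
  sphere-case (suc V) (suc F) vertices faces e = sphere-solution vertices faces (sphere-bound e)

  nonorientable-case : ∀ v fc → HasOrbits σ₁ σ₂ v → HasOrbits σ₀ σ₁ fc → n ≤ v + fc → ¬ Orientable → Solution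
  nonorientable-case zero    _       vertices _     _ _ = ⊥-elim (case proj₁ vertices f₀ of λ ())
  nonorientable-case (suc V) zero    _        faces _ _ = ⊥-elim (case proj₁ faces f₀ of λ ())
  nonorientable-case (suc V) (suc F) vertices faces n≤ = nonorientable-solution vertices faces (nonorientable-bound n≤)

proposition11 : (n : ℕ) (w : Fin (2 * n) → Fin n) → IsGaussCode w →
    (R : Lacet n w) →
    (Lacet.InSphere R ⊎ Lacet.InProjectivePlane R ⊎ Lacet.InKleinBottle R) →
    (γ : Fin n → Bool) → (∀ k → (γ k ≡ true) ⇔ Lacet.Black R k) →
    ∃ λ (δ : Fin n → Bool) → ∀ k y → LHS w γ k y ≡ RHS w δ k y
proposition11 n w gauss R surface γ γ-black = on surface
  where
  open Solutions gauss R γ γ-black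
  on : (Lacet.InSphere R ⊎ Lacet.InProjectivePlane R ⊎ Lacet.InKleinBottle R) → Solution
  on (inj₁ (v , fc , (vertices , faces) , v+fc≡n+2)) =
    sphere-case v fc vertices faces v+fc≡n+2
  on (inj₂ (inj₁ (v , fc , (vertices , faces) , v+fc≡n+1 , non-orientable))) =
    nonorientable-case v fc vertices faces (subst (n ≤_) (sym v+fc≡n+1) (ℕ.m≤m+n n 1)) non-orientable
  on (inj₂ (inj₂ (v , fc , (vertices , faces) , v+fc≡n , non-orientable))) =
    nonorientable-case v fc vertices faces (ℕ.≤-reflexive (sym v+fc≡n)) non-orientable
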